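{- Let $A$ be a symmetric $n\times n$ integer matrix with even diagonal entries, and let $$\mathcal B=\{e_1,f_1,\dots,e_{r+s},f_{r+s},g_1,\dots,g_{2t},a_1,\dots,a_p,h_1,\dots,h_m\}$$ be a $\mathbb Z$-basis of $\mathbb Z^n$ (listed in this order) whose Gram matrix with respect to $(\,,\,)$, reduced modulo $4$, is $$\mathrm{diag}\Big(r\begin{pmatrix}2&1\\1&2\end{pmatrix}, s\begin{pmatrix}0&1\\1&0\end{pmatrix}, t\begin{pmatrix}0&2\\2&0\end{pmatrix}, p(2), m(0)\Big).$$ Then (writing $v$ also for its coset mod $2\mathbb Z^n$) $\{g_1,\dots,g_{2t},a_1,\dots,a_p,h_1,\dots,h_m\}$ is a basis of $\overline V_0$ and $\{h_1,\dots,h_m\}$ is a basis of $\overline V_{000}$. Furthermore: (i) if $p=0$, then $\overline V_0=\overline V_{00}$; (ii) if $p=1$, then $\{g_1,\dots,g_{2t},h_1,\dots,h_m\}$ is a basis of $\overline V_{00}$; (iii) if $p=2$, then $\{g_1,\dots,g_{2t},a_1+a_2,h_1,\dots,h_m\}$ is a basis of $\overline V_{00}$; (iv) $\dim\overline V_{00}\ge1$ if and only if $p\ge2$ or $2t+m\ge1$; (v) $\dim(\overline V_0/\overline V_{00})\le1$, with equality if and only if $p\ge1$; (vi) $q(\overline V_0)=\{0\}$ if and only if $p=0$, and $q(\overline V_0)=\mathbb F_2$ if and only if $p\ge1$.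
   Context: $V=\mathbb Z^n$, $\overline V=\mathbb Z^n/2\mathbb Z^n$, $(v,w)=v^TAw$; the Gram matrix of a basis $\{v_i\}$ has entries $(v_i,v_j)$. $q=q_A:\overline V\to\mathbb F_2$, $q(v)=(v,v)/2\bmod 2$. $V_0=\{v\in V:(v,w)\equiv0\pmod2\ \forall w\in V\}$, $V_{00}=\{v\in V_0:(v,v)\equiv0\pmod4\}$, $V_{000}=\{v\in V_0:(v,w)\equiv0\pmod4\ \forall w\in V\}$; $\overline V_0=V_0/2V$, $\overline V_{00}=V_{00}/2V$, $\overline V_{000}=(V_{000}+2V)/2V$, which are $\mathbb F_2$-subspaces of $\overline V$. $\mathrm{diag}(\dots)$ with multiplicities denotes the block diagonal matrix with $r,s,t,p,m$ copies of the indicated blocks. -}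

module Defs where

open import Data.Nat as ℕ using (ℕ; zero; suc; _<ᵇ_; _≡ᵇ_)
open import Data.Integer as ℤ using (ℤ; +_; 0ℤ)
open import Data.Integer.Divisibility using (_∣_)
open import Data.Integer.DivMod using (_/ℕ_; _%ℕ_)
open import Data.Fin as Fin using (Fin; toℕ; _↑ˡ_; _↑ʳ_; combine; remQuot; splitAt)
open import Data.Bool using (Bool; true; false; _xor_; _∧_; not; if_then_else_)
open import Data.Product using (Σ; ∃; _×_; _,_)
open import Data.Sum using (inj₁; inj₂)
open import Relation.Binary.PropositionalEquality using (_≡_)
open import Relation.Nullary using (does)

Σℤ : ∀ {n} → (Fin n → ℤ) → ℤ
Σℤ {zero}  f = 0ℤ
Σℤ {suc n} f = f Fin.zero ℤ.+ Σℤ (λ i → f (Fin.suc i))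

Σ₂ : ∀ {n} → (Fin n → Bool) → Bool
Σ₂ {zero}  f = false
Σ₂ {suc n} f = f Fin.zero xor Σ₂ (λ i → f (Fin.suc i))

Vecℤ : ℕ → Set
Vecℤ n = Fin n → ℤ

Mat : ℕ → Set
Mat n = Fin n → Fin n → ℤ

form : ∀ {n} → Mat n → Vecℤ n → Vecℤ n → ℤ
form A v w = Σℤ (λ i → v i ℤ.* Σℤ (λ j → A i j ℤ.* w j))

Symmetric : ∀ {n} → Mat n → Set
Symmetric A = ∀ i j → A i j ≡ A j i

EvenDiagonal : ∀ {n} → Mat n → Set
EvenDiagonal A = ∀ i → (+ 2) ∣ A i i

combℤ : ∀ {k n} → (Fin k → ℤ) → (Fin k → Vecℤ n) → Vecℤ n
combℤ c b i = Σℤ (λ k → c k ℤ.* b k i)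

IsZBasis : ∀ {k n} → (Fin k → Vecℤ n) → Set
IsZBasis {k} {n} b =
  (∀ (v : Vecℤ n) → ∃ λ (c : Fin k → ℤ) → ∀ i → combℤ c b i ≡ v i)
  × (∀ (c : Fin k → ℤ) → (∀ i → combℤ c b i ≡ 0ℤ) → ∀ j → c j ≡ 0ℤ)

_≡mod4_ : ℤ → ℤ → Set
x ≡mod4 y = (+ 4) ∣ (x ℤ.- y)

-- V̄ = ℤⁿ/2ℤⁿ, realised as F₂ⁿ = Fin n → Bool

V̄ : ℕ → Set
V̄ n = Fin n → Bool

_≈_ : ∀ {n} → V̄ n → V̄ n → Set
x ≈ y = ∀ i → x i ≡ y i

0̄ : ∀ {n} → V̄ n
0̄ i = false

_⊕_ : ∀ {n} → V̄ n → V̄ n → V̄ n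
(x ⊕ y) i = x i xor y i

comb₂ : ∀ {k n} → (Fin k → Bool) → (Fin k → V̄ n) → V̄ n
comb₂ c u i = Σ₂ (λ k → c k ∧ u k i)

parity : ℤ → Bool
parity x = (x %ℕ 2) ≡ᵇ 1

red : ∀ {n} → Vecℤ n → V̄ n
red v i = parity (v i)

lift : ∀ {n} → V̄ n → Vecℤ n
lift x i = if x i then + 1 else 0ℤ

-- q(v) = (v,v)/2 mod 2 on V̄ (evaluated on a representative)
q : ∀ {n} → Mat n → V̄ n → Bool
q A x = parity (form A (lift x) (lift x) /ℕ 2)

InV0 : ∀ {n} → Mat n → Vecℤ n → Set
InV0 A v = ∀ w → (+ 2) ∣ form A v w

InV00 : ∀ {n} → Mat n → Vecℤ n → Set
InV00 A v = InV0 A v × (+ 4) ∣ form A v v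

InV000 : ∀ {n} → Mat n → Vecℤ n → Set
InV000 A v = InV0 A v × (∀ w → (+ 4) ∣ form A v w)

-- their images V̄₀ = V₀/2V, V̄₀₀ = V₀₀/2V, V̄₀₀₀ = (V₀₀₀+2V)/2V in V̄
V̄0 : ∀ {n} → Mat n → V̄ n → Set
V̄0 A x = ∃ λ v → InV0 A v × red v ≈ x

V̄00 : ∀ {n} → Mat n → V̄ n → Set
V̄00 A x = ∃ λ v → InV00 A v × red v ≈ x

V̄000 : ∀ {n} → Mat n → V̄ n → Set
V̄000 A x = ∃ λ v → InV000 A v × red v ≈ x

LinIndep₂ : ∀ {k n} → (Fin k → V̄ n) → Set
LinIndep₂ {k} u = ∀ (c : Fin k → Bool) → comb₂ c u ≈ 0̄ → ∀ j → c j ≡ false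

IsBasisOf : ∀ {k n} → (V̄ n → Set) → (Fin k → V̄ n) → Set
IsBasisOf {k} {n} S u =
  (∀ j → S (u j)) × LinIndep₂ u
  × (∀ (x : V̄ n) → S x → ∃ λ (c : Fin k → Bool) → comb₂ c u ≈ x)

HasDim : ∀ {n} → (V̄ n → Set) → ℕ → Set
HasDim {n} S d = Σ (Fin d → V̄ n) λ u → IsBasisOf S u

-- dim (S / W) = d  (for W ⊆ S): there are d elements of S whose classes
-- form a basis of the quotient S/W
HasQuotDim : ∀ {n} → (V̄ n → Set) → (V̄ n → Set) → ℕ → Set
HasQuotDim {n} S W d = Σ (Fin d → V̄ n) λ u →
  (∀ j → S (u j))
  × (∀ (c : Fin d → Bool) → W (comb₂ c u) → ∀ j → c j ≡ false)
  × (∀ (x : V̄ n) → S x → ∃ λ (c : Fin d → Bool) → W (x ⊕ comb₂ c u))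

module Layout (r s t p m : ℕ) where

  N₁ : ℕ
  N₁ = (r ℕ.+ s) ℕ.* 2

  N₂ : ℕ
  N₂ = t ℕ.* 2

  n : ℕ
  n = N₁ ℕ.+ (N₂ ℕ.+ (p ℕ.+ m))

  eI fI : Fin (r ℕ.+ s) → Fin n
  eI i = combine i Fin.zero ↑ˡ (N₂ ℕ.+ (p ℕ.+ m))
  fI i = combine i (Fin.suc Fin.zero) ↑ˡ (N₂ ℕ.+ (p ℕ.+ m))

  -- g_{2i+1}, g_{2i+2} (0-based i) sit at gI (combine i 0), gI (combine i 1)
  gI : Fin N₂ → Fin n
  gI k = N₁ ↑ʳ (k ↑ˡ (p ℕ.+ m))

  aI : Fin p → Fin n
  aI j = N₁ ↑ʳ (N₂ ↑ʳ (j ↑ˡ m))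

  hI : Fin m → Fin n
  hI j = N₁ ↑ʳ (N₂ ↑ʳ (p ↑ʳ j))

  data Pos : Set where
    pE pF : Fin (r ℕ.+ s) → Pos
    pG    : Fin t → Fin 2 → Pos
    pA    : Fin p → Pos
    pH    : Fin m → Pos

  pos : Fin n → Pos
  pos x with splitAt N₁ x
  ... | inj₁ y with remQuot {r ℕ.+ s} 2 y
  ...   | (i , Fin.zero) = pE i
  ...   | (i , Fin.suc _) = pF i
  pos x | inj₂ y with splitAt N₂ y
  ...   | inj₁ z with remQuot {t} 2 z
  ...     | (i , b) = pG i b
  pos x | inj₂ y | inj₂ z with splitAt p z
  ...     | inj₁ j = pA j
  ...     | inj₂ j = pH j

  eqF : ∀ {k} → Fin k → Fin k → Bool
  eqF i j = does (i Fin.≟ j)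

  entry : Pos → Pos → ℤ
  entry (pE i) (pE j) = if eqF i j ∧ (toℕ i <ᵇ r) then + 2 else 0ℤ
  entry (pF i) (pF j) = if eqF i j ∧ (toℕ i <ᵇ r) then + 2 else 0ℤ
  entry (pE i) (pF j) = if eqF i j then + 1 else 0ℤ
  entry (pF i) (pE j) = if eqF i j then + 1 else 0ℤ
  entry (pG i b) (pG j c) = if eqF i j ∧ not (eqF b c) then + 2 else 0ℤ
  entry (pA i) (pA j) = if eqF i j then + 2 else 0ℤ
  entry _ _ = 0ℤ

  gramTarget : Fin n → Fin n → ℤ
  gramTarget x y = entry (pos x) (pos y)

  module Fam (b : Fin n → Vecℤ n) where
    ḡ : Fin N₂ → V̄ n
    ḡ k = red (b (gI k))

    ā : Fin p → V̄ n
    ā j = red (b (aI j))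

    h̄ : Fin m → V̄ n
    h̄ j = red (b (hI j))

{-# OPTIONS --safe #-}

-- Write vectors in the basis b. Pairing v ∈ V₀ with f_i (resp. e_i) computes its e_i- (resp. f_i-)
-- coordinate modulo 2, since that column of the Gram matrix is even except for a single 1; so V̄₀ is
-- spanned by the classes of the g's, a's and h's, which lie in V̄₀ because their columns are even.
-- Modulo 4, pairing v ∈ V₀₀₀ with g_{i,1-β} and a_j gives twice its g_{i,β}- and a_j-coordinates,
-- which leaves the h's as a basis of V̄₀₀₀. On V̄₀ the value q(x) = (v,v)/2 mod 2 does not depend
-- on the lift v ∈ V₀, and q is additive because (v+w,v+w) = (v,v) + 2(v,w) + (w,w) with (v,w) even.
-- As q is 1 exactly on the a's, q(Σ c_k u_k) = Σ_j c_{a_j}; hence V̄₀₀ = ker q is spanned by the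
-- g's, the h's and the sums a₁ + a_{j+1}, and the remaining claims are linear algebra over F₂.

module Submission where

open import Defs
open import Data.Bool.Base using (Bool; true; false; _xor_; _∧_; if_then_else_)
import Data.Bool.Properties as Bool
open import Data.Empty using (⊥-elim)
open import Data.Fin.Base using (Fin; zero; suc; _↑ˡ_; _↑ʳ_; splitAt; combine; remQuot; opposite)
import Data.Fin.Properties as Fin
open import Data.Nat.Base as ℕ using (ℕ)
import Data.Nat.Properties as ℕ
open import Data.Product using (∃; _×_; _,_; proj₁; proj₂)
open import Data.Sum.Base using (_⊎_; inj₁; inj₂)
open import Data.Vec.Functional using (_++_; _∷_; take; drop)
open import Data.Vec.Functional.Properties using (lookup-++ˡ; lookup-++ʳ)
open import Function.Base using (_∘_)
open import Function.Bundles using (_⇔_; mk⇔; Equivalence)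
open import Relation.Binary.PropositionalEquality
open import Relation.Nullary.Negation using (¬_)
open import Relation.Nullary.Decidable using (yes; no; dec-true)
open import Algebra.Bundles using (CommutativeRing)

≈-sym : ∀ {n} {x y : V̄ n} → x ≈ y → y ≈ x
≈-sym x≈y i = sym (x≈y i)

≈-trans : ∀ {n} {x y z : V̄ n} → x ≈ y → y ≈ z → x ≈ z
≈-trans x≈y y≈z i = trans (x≈y i) (y≈z i)

↑-elim : ∀ {a b} {P : Fin (a ℕ.+ b) → Set} →
  (∀ i → P (i ↑ˡ b)) → (∀ j → P (a ↑ʳ j)) → ∀ l → P l
↑-elim {a} {P = P} left right l with splitAt a l in eq
... | inj₁ i = subst P (Fin.splitAt⁻¹-↑ˡ eq) (left i)
... | inj₂ j = subst P (Fin.splitAt⁻¹-↑ʳ eq) (right j)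

combine-remQuot⁻¹ : ∀ {a b} {l : Fin (a ℕ.* b)} {i j} → remQuot {a} b l ≡ (i , j) → combine i j ≡ l
combine-remQuot⁻¹ {a} {b} {l} eq =
  trans (cong (λ (i , j) → combine i j) (sym eq)) (Fin.combine-remQuot {a} b l)

∀-++ : ∀ {a b} {A : Set} {P : A → Set} {u : Fin a → A} {w : Fin b → A} →
  (∀ i → P (u i)) → (∀ j → P (w j)) → ∀ l → P ((u ++ w) l)
∀-++ {a} Pu Pw l with splitAt a l
... | inj₁ i = Pu i
... | inj₂ j = Pw j

-- Linear algebra over F₂

true≢false : true ≢ false
true≢false ()

xor≡false⇒≡ : ∀ α β → α xor β ≡ false → α ≡ β
xor≡false⇒≡ false β     α⊕β≡false = sym α⊕β≡false
xor≡false⇒≡ true  true  _         = refl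

Σ₂-cong : ∀ {k} {f g : Fin k → Bool} → f ≗ g → Σ₂ f ≡ Σ₂ g
Σ₂-cong {ℕ.zero}  f≗g = refl
Σ₂-cong {ℕ.suc k} f≗g = cong₂ _xor_ (f≗g zero) (Σ₂-cong (f≗g ∘ suc))

Σ₂-false : ∀ {k} {f : Fin k → Bool} → (∀ i → f i ≡ false) → Σ₂ f ≡ false
Σ₂-false {ℕ.zero}  f≡false = refl
Σ₂-false {ℕ.suc k} f≡false = cong₂ _xor_ (f≡false zero) (Σ₂-false (f≡false ∘ suc))

Σ₂-splitAt : ∀ a {b} (f : Fin (a ℕ.+ b) → Bool) → Σ₂ f ≡ Σ₂ (take a f) xor Σ₂ (drop a f)
Σ₂-splitAt ℕ.zero    f = refl
Σ₂-splitAt (ℕ.suc a) f =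
  trans (cong (f zero xor_) (Σ₂-splitAt a (f ∘ suc))) (sym (Bool.xor-assoc (f zero) _ _))

Σ₂-xor : ∀ {k} (f g : Fin k → Bool) → Σ₂ (λ i → f i xor g i) ≡ Σ₂ f xor Σ₂ g
Σ₂-xor {ℕ.zero}  f g = refl
Σ₂-xor {ℕ.suc k} f g = trans (cong ((f zero xor g zero) xor_) (Σ₂-xor (f ∘ suc) (g ∘ suc)))
  (interchange (f zero) (g zero) (Σ₂ (f ∘ suc)) (Σ₂ (g ∘ suc)))
  where open import Algebra.Properties.CommutativeSemigroup
          (CommutativeRing.+-commutativeSemigroup Bool.xor-∧-commutativeRing) using (interchange)

Σ₂-∧ʳ : ∀ {k} (f : Fin k → Bool) (β : Bool) → Σ₂ (λ i → f i ∧ β) ≡ Σ₂ f ∧ β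
Σ₂-∧ʳ f true  = trans (Σ₂-cong (Bool.∧-identityʳ ∘ f)) (sym (Bool.∧-identityʳ _))
Σ₂-∧ʳ f false = trans (Σ₂-false (Bool.∧-zeroʳ ∘ f)) (sym (Bool.∧-zeroʳ _))

Σ₂-∧-false : ∀ {k} (c : Fin k → Bool) {f : Fin k → Bool} →
  (∀ j → f j ≡ false) → Σ₂ (λ j → c j ∧ f j) ≡ false
Σ₂-∧-false c f≡false = Σ₂-false (λ j → trans (cong (c j ∧_) (f≡false j)) (Bool.∧-zeroʳ (c j)))

Σ₂-∧-true : ∀ {k} (c : Fin k → Bool) {f : Fin k → Bool} →
  (∀ j → f j ≡ true) → Σ₂ (λ j → c j ∧ f j) ≡ Σ₂ c
Σ₂-∧-true c f≡true = Σ₂-cong (λ j → trans (cong (c j ∧_) (f≡true j)) (Bool.∧-identityʳ (c j)))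

comb₂-cong : ∀ {k n} {c c′ : Fin k → Bool} {u u′ : Fin k → V̄ n} →
  c ≗ c′ → (∀ j → u j ≈ u′ j) → comb₂ c u ≈ comb₂ c′ u′
comb₂-cong c≗c′ u≈u′ i = Σ₂-cong (λ j → cong₂ _∧_ (c≗c′ j) (u≈u′ j i))

comb₂-false : ∀ {k n} {c : Fin k → Bool} (u : Fin k → V̄ n) →
  (∀ j → c j ≡ false) → comb₂ c u ≈ 0̄
comb₂-false u c≡false i = Σ₂-false (λ j → cong (_∧ u j i) (c≡false j))

comb₂-splitAt : ∀ {n} a {b} (c : Fin (a ℕ.+ b) → Bool) (u : Fin (a ℕ.+ b) → V̄ n) →
  comb₂ c u ≈ (comb₂ (take a c) (take a u) ⊕ comb₂ (drop a c) (drop a u))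
comb₂-splitAt a c u i = Σ₂-splitAt a (λ j → c j ∧ u j i)

comb₂-++ : ∀ {n} {a b} (c : Fin (a ℕ.+ b) → Bool) (u : Fin a → V̄ n) (w : Fin b → V̄ n) →
  comb₂ c (u ++ w) ≈ (comb₂ (take a c) u ⊕ comb₂ (drop a c) w)
comb₂-++ {a = a} c u w i = trans (comb₂-splitAt a c (u ++ w) i)
  (cong₂ _xor_ (comb₂-cong (λ _ → refl) (λ j → cong-app (lookup-++ˡ u w j)) i)
               (comb₂-cong (λ _ → refl) (λ j → cong-app (lookup-++ʳ u w j)) i))

comb₂-++-++ : ∀ {n a b} (c : Fin a → Bool) (d : Fin b → Bool) (u : Fin a → V̄ n) (w : Fin b → V̄ n) →
  comb₂ (c ++ d) (u ++ w) ≈ (comb₂ c u ⊕ comb₂ d w)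
comb₂-++-++ c d u w i = trans (comb₂-++ (c ++ d) u w i)
  (cong₂ _xor_ (comb₂-cong {u = u} (lookup-++ˡ c d) (λ _ _ → refl) i)
               (comb₂-cong {u = w} (lookup-++ʳ c d) (λ _ _ → refl) i))

comb₂-++₃ : ∀ {n a b e} (c : Fin (a ℕ.+ (b ℕ.+ e)) → Bool)
  (u : Fin a → V̄ n) (w : Fin b → V̄ n) (v : Fin e → V̄ n) →
  comb₂ c (u ++ (w ++ v)) ≈
    (comb₂ (take a c) u ⊕ (comb₂ (take b (drop a c)) w ⊕ comb₂ (drop b (drop a c)) v))
comb₂-++₃ {a = a} c u w v i =
  trans (comb₂-++ c u (w ++ v) i) (cong (comb₂ (take a c) u i xor_) (comb₂-++ (drop a c) w v i))

comb₂-++-++₃ : ∀ {n a b e} (c₁ : Fin a → Bool) (c₂ : Fin b → Bool) (c₃ : Fin e → Bool)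
  (u : Fin a → V̄ n) (w : Fin b → V̄ n) (v : Fin e → V̄ n) →
  comb₂ (c₁ ++ (c₂ ++ c₃)) (u ++ (w ++ v)) ≈ (comb₂ c₁ u ⊕ (comb₂ c₂ w ⊕ comb₂ c₃ v))
comb₂-++-++₃ c₁ c₂ c₃ u w v i =
  trans (comb₂-++-++ c₁ (c₂ ++ c₃) u (w ++ v) i) (cong (comb₂ c₁ u i xor_) (comb₂-++-++ c₂ c₃ w v i))

comb₂-empty : ∀ {k n} {c : Fin k → Bool} (u : Fin k → V̄ n) → k ≡ 0 → comb₂ c u ≈ 0̄
comb₂-empty u refl i = refl

comb₂-single : ∀ {k n} {c : Fin k → Bool} (u : Fin k → V̄ n) →
  k ℕ.≤ 1 → Σ₂ c ≡ false → comb₂ c u ≈ 0̄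
comb₂-single {ℕ.zero}                 u _ _ i = refl
comb₂-single {ℕ.suc ℕ.zero} {c = c} u _ Σc≡false i
  rewrite trans (sym (Bool.xor-identityʳ (c zero))) Σc≡false = refl
comb₂-single {ℕ.suc (ℕ.suc _)} u (ℕ.s≤s ()) _

LinIndep₂-resp : ∀ {k n} {u w : Fin k → V̄ n} → (∀ j → u j ≈ w j) → LinIndep₂ u → LinIndep₂ w
LinIndep₂-resp u≈w indep c comb≈0 =
  indep c (≈-trans (comb₂-cong {c = c} (λ _ → refl) u≈w) comb≈0)

LinIndep₂-drop : ∀ {n} a {b} {u : Fin (a ℕ.+ b) → V̄ n} → LinIndep₂ u → LinIndep₂ (drop a u)
LinIndep₂-drop a {u = u} indep c comb≈0 j =
  trans (sym (lookup-++ʳ zeros c j)) (indep (zeros ++ c) padded≈0 (a ↑ʳ j))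
  where
  zeros : Fin a → Bool
  zeros _ = false
  padded≈0 : comb₂ (zeros ++ c) u ≈ 0̄
  padded≈0 i = trans (comb₂-splitAt a (zeros ++ c) u i)
    (cong₂ _xor_ (comb₂-false (take a u) (lookup-++ˡ zeros c) i)
                 (trans (comb₂-cong {u = drop a u} (lookup-++ʳ zeros c) (λ _ _ → refl) i) (comb≈0 i)))

LinIndep₂⇒head≉0̄ : ∀ {k n} {u : Fin (ℕ.suc k) → V̄ n} → LinIndep₂ u → ¬ (u zero ≈ 0̄)
LinIndep₂⇒head≉0̄ {k = k} indep u₀≈0 =
  true≢false (indep (true ∷ λ _ → false)
                    (λ i → cong₂ _xor_ (u₀≈0 i) (Σ₂-false {k} (λ _ → refl))) zero)

IsBasisOf-resp : ∀ {k n} {S S′ : V̄ n → Set} {u : Fin k → V̄ n} →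
  (∀ x → S x ⇔ S′ x) → IsBasisOf S u → IsBasisOf S′ u
IsBasisOf-resp S⇔S′ (u∈S , indep , spans) =
  (λ j → to (S⇔S′ _) (u∈S j)) , indep , (λ x x∈S′ → spans x (from (S⇔S′ x) x∈S′))
  where open Equivalence

comb₂-differences : ∀ {k n} (a : Fin (ℕ.suc k) → V̄ n) (c : Fin k → Bool) →
  comb₂ c (λ j → a zero ⊕ a (suc j)) ≈ comb₂ (Σ₂ c ∷ c) a
comb₂-differences a c i = trans (Σ₂-cong (λ j → Bool.∧-distribˡ-xor (c j) (a zero i) (a (suc j) i)))
  (trans (Σ₂-xor (λ j → c j ∧ a zero i) (λ j → c j ∧ a (suc j) i))
         (cong (_xor Σ₂ (λ j → c j ∧ a (suc j) i)) (Σ₂-∧ʳ c (a zero i))))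

-- The integer operators are opened only in this block: the statement of lemma2p7 uses those of ℕ.
module _ where

  open import Data.Integer.Base using (ℤ; +_; -[1+_]; 0ℤ; _+_; _*_; _-_; -_; _/ℕ_; _%ℕ_)
  import Data.Integer.Properties as ℤ
  open import Data.Integer.DivMod using (a≡a%ℕn+[a/ℕn]*n; n%ℕd<d)
  open import Data.Integer.Divisibility.Signed
    using ( _∣_; divides; ∣ᵤ⇒∣; ∣⇒∣ᵤ; ∣m∣n⇒∣m+n; ∣m∣n⇒∣m-n; ∣m⇒∣-m; ∣n⇒∣m*n; ∣m⇒∣m*n; ∣-trans
          ; *-monoʳ-∣; *-cancelʳ-∣)
  open import Data.Integer.Tactic.RingSolver using (solve-∀)
  open ≡-Reasoning

  Σℤ-cong : ∀ {k} {f g : Fin k → ℤ} → f ≗ g → Σℤ f ≡ Σℤ g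
  Σℤ-cong {ℕ.zero}  f≗g = refl
  Σℤ-cong {ℕ.suc k} f≗g = cong₂ _+_ (f≗g zero) (Σℤ-cong (f≗g ∘ suc))

  Σℤ-0 : ∀ {k} → Σℤ {k} (λ _ → 0ℤ) ≡ 0ℤ
  Σℤ-0 {ℕ.zero}  = refl
  Σℤ-0 {ℕ.suc k} = trans (ℤ.+-identityˡ _) (Σℤ-0 {k})

  Σℤ-+ : ∀ {k} (f g : Fin k → ℤ) → Σℤ (λ i → f i + g i) ≡ Σℤ f + Σℤ g
  Σℤ-+ {ℕ.zero}  f g = refl
  Σℤ-+ {ℕ.suc k} f g =
    trans (cong (_+_ (f zero + g zero)) (Σℤ-+ (f ∘ suc) (g ∘ suc)))
      (swap (f zero) (g zero) (Σℤ (f ∘ suc)) (Σℤ (g ∘ suc)))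
    where
    swap : ∀ a b c d → a + b + (c + d) ≡ a + c + (b + d)
    swap = solve-∀

  Σℤ-- : ∀ {k} (f g : Fin k → ℤ) → Σℤ (λ i → f i - g i) ≡ Σℤ f - Σℤ g
  Σℤ-- {ℕ.zero}  f g = refl
  Σℤ-- {ℕ.suc k} f g =
    trans (cong (_+_ (f zero - g zero)) (Σℤ-- (f ∘ suc) (g ∘ suc)))
      (swap (f zero) (g zero) (Σℤ (f ∘ suc)) (Σℤ (g ∘ suc)))
    where
    swap : ∀ a b c d → a - b + (c - d) ≡ a + c - (b + d)
    swap = solve-∀

  Σℤ-*ˡ : ∀ {k} a (f : Fin k → ℤ) → Σℤ (λ i → a * f i) ≡ a * Σℤ f
  Σℤ-*ˡ {ℕ.zero}  a f = sym (ℤ.*-zeroʳ a)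
  Σℤ-*ˡ {ℕ.suc k} a f =
    trans (cong (_+_ (a * f zero)) (Σℤ-*ˡ a (f ∘ suc))) (sym (ℤ.*-distribˡ-+ a (f zero) _))

  Σℤ-comm : ∀ {k l} (F : Fin k → Fin l → ℤ) →
    Σℤ (λ i → Σℤ (λ j → F i j)) ≡ Σℤ (λ j → Σℤ (λ i → F i j))
  Σℤ-comm {ℕ.zero}  {l} F = sym (Σℤ-0 {l})
  Σℤ-comm {ℕ.suc k}     F = trans (cong (_+_ (Σℤ (F zero))) (Σℤ-comm (F ∘ suc)))
    (sym (Σℤ-+ (F zero) (λ j → Σℤ (λ i → F (suc i) j))))

  ∣Σℤ : ∀ {k} {M} {f : Fin k → ℤ} → (∀ i → M ∣ f i) → M ∣ Σℤ f
  ∣Σℤ {ℕ.zero}  M∣f = divides 0ℤ refl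
  ∣Σℤ {ℕ.suc k} M∣f = ∣m∣n⇒∣m+n (M∣f zero) (∣Σℤ (M∣f ∘ suc))

  ∣Σℤ-minus-term : ∀ {k} {M} (f : Fin k → ℤ) l → (∀ i → i ≢ l → M ∣ f i) → M ∣ Σℤ f - f l
  ∣Σℤ-minus-term {M = M} f zero M∣f =
    subst (M ∣_) (rearrange (f zero) _) (∣Σℤ (λ i → M∣f (suc i) (λ ())))
    where
    rearrange : ∀ a b → b ≡ a + b - a
    rearrange = solve-∀
  ∣Σℤ-minus-term {M = M} f (suc l) M∣f =
    subst (M ∣_) (rearrange (f zero) _ _)
      (∣m∣n⇒∣m+n (M∣f zero (λ ()))
        (∣Σℤ-minus-term (f ∘ suc) l (λ i i≢l → M∣f (suc i) (i≢l ∘ Fin.suc-injective))))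
    where
    rearrange : ∀ a b c → a + (b - c) ≡ a + b - c
    rearrange = solve-∀

  bit : Bool → ℤ
  bit β = if β then + 1 else 0ℤ

  z≡bit[parity]+[z/2]*2 : ∀ z → z ≡ bit (parity z) + (z /ℕ 2) * + 2
  z≡bit[parity]+[z/2]*2 z =
    trans (a≡a%ℕn+[a/ℕn]*n z 2) (cong (_+ (z /ℕ 2) * + 2) (remainder (z %ℕ 2) (n%ℕd<d z 2)))
    where
    remainder : ∀ r → r ℕ.< 2 → + r ≡ bit (r ℕ.≡ᵇ 1)
    remainder 0 _ = refl
    remainder 1 _ = refl
    remainder (ℕ.suc (ℕ.suc r)) (ℕ.s≤s (ℕ.s≤s ()))

  2∣bit[parity]-z : ∀ z → + 2 ∣ bit (parity z) - z
  2∣bit[parity]-z z = divides (- (z /ℕ 2)) (begin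
    bit (parity z) - z
      ≡⟨ cong (_-_ (bit (parity z))) (z≡bit[parity]+[z/2]*2 z) ⟩
    bit (parity z) - (bit (parity z) + z /ℕ 2 * + 2)
      ≡⟨ cancel (bit (parity z)) (z /ℕ 2) ⟩
    - (z /ℕ 2) * + 2 ∎)
    where
    cancel : ∀ a h → a - (a + h * + 2) ≡ - h * + 2
    cancel = solve-∀

  2∤1 : ¬ (+ 2 ∣ + 1)
  2∤1 (divides (+ ℕ.zero)  ())
  2∤1 (divides (+ ℕ.suc _) ())
  2∤1 (divides -[1+ _ ]    ())

  bit-injective-mod2 : ∀ α β → + 2 ∣ bit α - bit β → α ≡ β
  bit-injective-mod2 false false _ = refl
  bit-injective-mod2 true  true  _ = refl
  bit-injective-mod2 true  false 2∣1  = ⊥-elim (2∤1 2∣1)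
  bit-injective-mod2 false true  2∣-1 = ⊥-elim (2∤1 (∣m⇒∣-m 2∣-1))

  parity-cong : ∀ {a b} → + 2 ∣ a - b → parity a ≡ parity b
  parity-cong {a} {b} 2∣a-b = bit-injective-mod2 _ _
    (subst (+ 2 ∣_) (rearrange (bit (parity a)) (bit (parity b)) a b)
      (∣m∣n⇒∣m+n (∣m∣n⇒∣m+n (2∣bit[parity]-z a) 2∣a-b) (∣m⇒∣-m (2∣bit[parity]-z b))))
    where
    rearrange : ∀ x y a b → x - a + (a - b) + - (y - b) ≡ x - y
    rearrange = solve-∀

  parity-bit : ∀ β → parity (bit β) ≡ β
  parity-bit false = refl
  parity-bit true  = refl

  2∣⇒parity≡false : ∀ {z} → + 2 ∣ z → parity z ≡ false
  2∣⇒parity≡false {z} 2∣z = parity-cong {z} {0ℤ} (subst (+ 2 ∣_) (sym (ℤ.+-identityʳ z)) 2∣z)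

  parity≡false⇒2∣ : ∀ {z} → parity z ≡ false → + 2 ∣ z
  parity≡false⇒2∣ {z} parity≡false = subst (+ 2 ∣_) (negate z)
    (∣m⇒∣-m (subst (λ β → + 2 ∣ bit β - z) parity≡false (2∣bit[parity]-z z)))
    where
    negate : ∀ z → - (0ℤ - z) ≡ z
    negate = solve-∀

  parity-+ : ∀ a b → parity (a + b) ≡ parity a xor parity b
  parity-+ a b = trans (parity-cong {a + b} 2∣difference) (bits (parity a) (parity b))
    where
    rearrange : ∀ a b x y → - (x - a + (y - b)) ≡ a + b - (x + y)
    rearrange = solve-∀
    2∣difference : + 2 ∣ a + b - (bit (parity a) + bit (parity b))
    2∣difference = subst (+ 2 ∣_) (rearrange a b (bit (parity a)) (bit (parity b)))
      (∣m⇒∣-m (∣m∣n⇒∣m+n (2∣bit[parity]-z a) (2∣bit[parity]-z b)))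
    bits : ∀ α β → parity (bit α + bit β) ≡ α xor β
    bits false false = refl
    bits false true  = refl
    bits true  false = refl
    bits true  true  = refl

  parity-* : ∀ a b → parity (a * b) ≡ parity a ∧ parity b
  parity-* a b = trans (parity-cong {a * b} 2∣difference) (bits (parity a) (parity b))
    where
    x = bit (parity a)
    y = bit (parity b)
    rearrange : ∀ a b x y → - (x * (y - b)) - (x - a) * y + (x - a) * (y - b) ≡ a * b - x * y
    rearrange = solve-∀
    2∣difference : + 2 ∣ a * b - x * y
    2∣difference = subst (+ 2 ∣_) (rearrange a b x y)
      (∣m∣n⇒∣m+n (∣m∣n⇒∣m-n (∣m⇒∣-m (∣n⇒∣m*n x (2∣bit[parity]-z b)))
                             (∣m⇒∣m*n y (2∣bit[parity]-z a)))
                 (∣m⇒∣m*n (y - b) (2∣bit[parity]-z a)))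
    bits : ∀ α β → parity (bit α * bit β) ≡ α ∧ β
    bits false false = refl
    bits false true  = refl
    bits true  false = refl
    bits true  true  = refl

  infixl 6 _+ᵥ_
  infixr 7 _·ᵥ_

  _+ᵥ_ : ∀ {n} → Vecℤ n → Vecℤ n → Vecℤ n
  (v +ᵥ w) i = v i + w i

  _·ᵥ_ : ∀ {n} → ℤ → Vecℤ n → Vecℤ n
  (a ·ᵥ v) i = a * v i

  red-+ᵥ : ∀ {n} (v w : Vecℤ n) → red (v +ᵥ w) ≈ (red v ⊕ red w)
  red-+ᵥ v w i = parity-+ (v i) (w i)

  red-combℤ : ∀ {k n} (d : Fin k → ℤ) (b : Fin k → Vecℤ n) →
    red (combℤ d b) ≈ comb₂ (parity ∘ d) (red ∘ b)
  red-combℤ {ℕ.zero}  d b i = refl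
  red-combℤ {ℕ.suc k} d b i = trans (parity-+ (d zero * b zero i) _)
    (cong₂ _xor_ (parity-* (d zero) (b zero i)) (red-combℤ (d ∘ suc) (b ∘ suc) i))

  lift∘red : ∀ {n} (v : Vecℤ n) → ∃ λ y → lift (red v) ≗ v +ᵥ + 2 ·ᵥ y
  lift∘red v = (λ i → quotient (2∣bit[parity]-z (v i))) , λ i → begin
    bit (parity (v i))                           ≡⟨ split (bit (parity (v i))) (v i) ⟩
    v i + (bit (parity (v i)) - v i)             ≡⟨ cong (_+_ (v i)) (equality (2∣bit[parity]-z (v i))) ⟩
    v i + quotient (2∣bit[parity]-z (v i)) * + 2 ≡⟨ cong (_+_ (v i)) (ℤ.*-comm _ (+ 2)) ⟩
    v i + + 2 * quotient (2∣bit[parity]-z (v i)) ∎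
    where
    open _∣_
    split : ∀ x v → x ≡ v + (x - v)
    split = solve-∀

  record HalfParity (X : ℤ) (β : Bool) : Set where
    constructor halfParity
    field 4∣X-2β : + 4 ∣ X - bit β * + 2

  HalfParity-unique : ∀ {X α β} → HalfParity X α → HalfParity X β → α ≡ β
  HalfParity-unique {X} {α} {β} (halfParity 4∣X-2α) (halfParity 4∣X-2β) =
    bit-injective-mod2 α β (*-cancelʳ-∣ (+ 2)
      (subst (+ 4 ∣_) (rearrange X (bit α) (bit β)) (∣m∣n⇒∣m-n 4∣X-2β 4∣X-2α)))
    where
    rearrange : ∀ X a b → X - b * + 2 - (X - a * + 2) ≡ (a - b) * + 2
    rearrange = solve-∀

  HalfParity-+ : ∀ {X Y α β} → HalfParity X α → HalfParity Y β → HalfParity (X + Y) (α xor β)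
  HalfParity-+ {X} {Y} {α} {β} (halfParity 4∣X-2α) (halfParity 4∣Y-2β) = halfParity
    (subst (+ 4 ∣_) (trans (rearrange X Y (bit α) (bit β) (bit (α ∧ β)))
                           (cong (λ z → X + Y - z * + 2) (sym (bit-xor α β))))
      (∣m∣n⇒∣m+n (∣m∣n⇒∣m+n 4∣X-2α 4∣Y-2β) (divides (bit (α ∧ β)) refl)))
    where
    rearrange : ∀ X Y a b c → X - a * + 2 + (Y - b * + 2) + c * + 4 ≡ X + Y - (a + b - c * + 2) * + 2
    rearrange = solve-∀
    bit-xor : ∀ α β → bit (α xor β) ≡ bit α + bit β - bit (α ∧ β) * + 2
    bit-xor false false = refl
    bit-xor false true  = refl
    bit-xor true  false = refl
    bit-xor true  true  = refl

  HalfParity-resp : ∀ {X Y β} → + 4 ∣ X - Y → HalfParity Y β → HalfParity X β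
  HalfParity-resp {X} {Y} {β} 4∣X-Y (halfParity 4∣Y-2β) =
    halfParity (subst (+ 4 ∣_) (rearrange X Y (bit β * + 2)) (∣m∣n⇒∣m+n 4∣X-Y 4∣Y-2β))
    where
    rearrange : ∀ X Y z → X - Y + (Y - z) ≡ X - z
    rearrange = solve-∀

  HalfParity-false⇒4∣ : ∀ {X} → HalfParity X false → + 4 ∣ X
  HalfParity-false⇒4∣ {X} (halfParity 4∣X-0) = subst (+ 4 ∣_) (ℤ.+-identityʳ X) 4∣X-0

  4∣⇒HalfParity-false : ∀ {X} → + 4 ∣ X → HalfParity X false
  4∣⇒HalfParity-false {X} 4∣X = halfParity (subst (+ 4 ∣_) (sym (ℤ.+-identityʳ X)) 4∣X)

  HalfParity-half : ∀ {X} → + 2 ∣ X → HalfParity X (parity (X /ℕ 2))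
  HalfParity-half {X} 2∣X = halfParity (divides (h /ℕ 2) (begin
    X - bit (parity h) * + 2
      ≡⟨ cong (λ x → x - bit (parity h) * + 2) X≡h*2 ⟩
    h * + 2 - bit (parity h) * + 2
      ≡⟨ cong (λ y → y * + 2 - bit (parity h) * + 2) (z≡bit[parity]+[z/2]*2 h) ⟩
    (bit (parity h) + h /ℕ 2 * + 2) * + 2 - bit (parity h) * + 2
      ≡⟨ simplify (bit (parity h)) (h /ℕ 2) ⟩
    h /ℕ 2 * + 4 ∎))
    where
    h = X /ℕ 2
    X≡h*2 : X ≡ h * + 2
    X≡h*2 = trans (z≡bit[parity]+[z/2]*2 X)
      (trans (cong (λ β → bit β + h * + 2) (2∣⇒parity≡false 2∣X)) (ℤ.+-identityˡ (h * + 2)))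
    simplify : ∀ a j → (a + j * + 2) * + 2 - a * + 2 ≡ j * + 4
    simplify = solve-∀

  module _ {n} (A : Mat n) where

    form-cong : ∀ {v v′ w w′} → v ≗ v′ → w ≗ w′ → form A v w ≡ form A v′ w′
    form-cong v≗v′ w≗w′ =
      Σℤ-cong (λ i → cong₂ _*_ (v≗v′ i) (Σℤ-cong (λ j → cong (A i j *_) (w≗w′ j))))

    form-+ˡ : ∀ v w z → form A (v +ᵥ w) z ≡ form A v z + form A w z
    form-+ˡ v w z = trans (Σℤ-cong (λ i → ℤ.*-distribʳ-+ (Σℤ (λ j → A i j * z j)) (v i) (w i)))
      (Σℤ-+ (λ i → v i * Σℤ (λ j → A i j * z j)) (λ i → w i * Σℤ (λ j → A i j * z j)))

    form-·ˡ : ∀ a v z → form A (a ·ᵥ v) z ≡ a * form A v z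
    form-·ˡ a v z = trans (Σℤ-cong (λ i → ℤ.*-assoc a (v i) (Σℤ (λ j → A i j * z j))))
      (Σℤ-*ˡ a (λ i → v i * Σℤ (λ j → A i j * z j)))

    form-combℤˡ : ∀ {k} (d : Fin k → ℤ) (b : Fin k → Vecℤ n) (w : Vecℤ n) →
      form A (combℤ d b) w ≡ Σℤ (λ l → d l * form A (b l) w)
    form-combℤˡ {ℕ.zero}  d b w = Σℤ-0 {n}
    form-combℤˡ {ℕ.suc k} d b w = begin
      form A (d zero ·ᵥ b zero +ᵥ combℤ (d ∘ suc) (b ∘ suc)) w
        ≡⟨ form-+ˡ (d zero ·ᵥ b zero) (combℤ (d ∘ suc) (b ∘ suc)) w ⟩
      form A (d zero ·ᵥ b zero) w + form A (combℤ (d ∘ suc) (b ∘ suc)) w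
        ≡⟨ cong₂ _+_ (form-·ˡ (d zero) (b zero) w) (form-combℤˡ (d ∘ suc) (b ∘ suc) w) ⟩
      d zero * form A (b zero) w + Σℤ (λ l → d (suc l) * form A (b (suc l)) w) ∎

    form-comm : Symmetric A → ∀ v w → form A v w ≡ form A w v
    form-comm A-sym v w = begin
      Σℤ (λ i → v i * Σℤ (λ j → A i j * w j))
        ≡⟨ Σℤ-cong (λ i → sym (Σℤ-*ˡ (v i) (λ j → A i j * w j))) ⟩
      Σℤ (λ i → Σℤ (λ j → v i * (A i j * w j)))
        ≡⟨ Σℤ-comm (λ i j → v i * (A i j * w j)) ⟩
      Σℤ (λ j → Σℤ (λ i → v i * (A i j * w j)))
        ≡⟨ Σℤ-cong (λ j → Σℤ-cong (λ i → reorder (v i) (A i j) (A j i) (w j) (A-sym i j))) ⟩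
      Σℤ (λ j → Σℤ (λ i → w j * (A j i * v i)))
        ≡⟨ Σℤ-cong (λ j → Σℤ-*ˡ (w j) (λ i → A j i * v i)) ⟩
      Σℤ (λ j → w j * Σℤ (λ i → A j i * v i)) ∎
      where
      reorder : ∀ a x y c → x ≡ y → a * (x * c) ≡ c * (y * a)
      reorder a x _ c refl = commute a x c
        where
        commute : ∀ a x c → a * (x * c) ≡ c * (x * a)
        commute = solve-∀

  -- The quadratic refinement q on V̄₀

  module QuadraticRefinement {n} (A : Mat n) (A-sym : Symmetric A) where

    form-·ʳ : ∀ a v z → form A z (a ·ᵥ v) ≡ a * form A z v
    form-·ʳ a v z = trans (form-comm A A-sym z (a ·ᵥ v))
      (trans (form-·ˡ A a v z) (cong (a *_) (form-comm A A-sym v z)))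

    form-+ʳ : ∀ v w z → form A z (v +ᵥ w) ≡ form A z v + form A z w
    form-+ʳ v w z = trans (form-comm A A-sym z (v +ᵥ w))
      (trans (form-+ˡ A v w z) (cong₂ _+_ (form-comm A A-sym v z) (form-comm A A-sym w z)))

    form-+ᵥ-diag : ∀ v w → form A (v +ᵥ w) (v +ᵥ w) ≡ form A v v + + 2 * form A v w + form A w w
    form-+ᵥ-diag v w = begin
      form A (v +ᵥ w) (v +ᵥ w)
        ≡⟨ form-+ˡ A v w (v +ᵥ w) ⟩
      form A v (v +ᵥ w) + form A w (v +ᵥ w)
        ≡⟨ cong₂ _+_ (form-+ʳ v w v) (form-+ʳ v w w) ⟩
      form A v v + form A v w + (form A w v + form A w w)
        ≡⟨ cong (λ x → form A v v + form A v w + (x + form A w w)) (form-comm A A-sym w v) ⟩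
      form A v v + form A v w + (form A v w + form A w w)
        ≡⟨ collect (form A v v) (form A v w) (form A w w) ⟩
      form A v v + + 2 * form A v w + form A w w ∎
      where
      collect : ∀ a b c → a + b + (b + c) ≡ a + + 2 * b + c
      collect = solve-∀

    form-+2·-diag : ∀ v y →
      form A (v +ᵥ + 2 ·ᵥ y) (v +ᵥ + 2 ·ᵥ y) ≡ form A v v + (form A v y + form A y y) * + 4
    form-+2·-diag v y = begin
      form A (v +ᵥ + 2 ·ᵥ y) (v +ᵥ + 2 ·ᵥ y)
        ≡⟨ form-+ᵥ-diag v (+ 2 ·ᵥ y) ⟩
      form A v v + + 2 * form A v (+ 2 ·ᵥ y) + form A (+ 2 ·ᵥ y) (+ 2 ·ᵥ y)
        ≡⟨ cong₂ (λ x z → form A v v + + 2 * x + z) (form-·ʳ (+ 2) y v)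
                 (trans (form-·ˡ A (+ 2) y (+ 2 ·ᵥ y)) (cong (+ 2 *_) (form-·ʳ (+ 2) y y))) ⟩
      form A v v + + 2 * (+ 2 * form A v y) + + 2 * (+ 2 * form A y y)
        ≡⟨ collect (form A v v) (form A v y) (form A y y) ⟩
      form A v v + (form A v y + form A y y) * + 4 ∎
      where
      collect : ∀ a b c → a + + 2 * (+ 2 * b) + + 2 * (+ 2 * c) ≡ a + (b + c) * + 4
      collect = solve-∀

    2∣form : ∀ {v} → InV0 A v → ∀ w → + 2 ∣ form A v w
    2∣form {v} v∈V₀ w = ∣ᵤ⇒∣ {i = form A v w} (v∈V₀ w)

    InV0-+ : ∀ {v w} → InV0 A v → InV0 A w → InV0 A (v +ᵥ w)
    InV0-+ {v} {w} v∈V₀ w∈V₀ z =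
      ∣⇒∣ᵤ (subst (+ 2 ∣_) (sym (form-+ˡ A v w z))
                (∣m∣n⇒∣m+n (2∣form {v} v∈V₀ z) (2∣form {w} w∈V₀ z)))

    -- Two lifts of x differ by some 2y, which changes (v,v) by 4((v,y) + (y,y)).
    q-halfParity : ∀ v {x} → InV0 A v → red v ≈ x → HalfParity (form A v v) (q A x)
    q-halfParity v {x} v∈V₀ v≈x = HalfParity-resp 4∣vv-LL (HalfParity-half 2∣LL)
      where
      y = proj₁ (lift∘red v)
      L≡v+2y : form A (lift x) (lift x) ≡ form A v v + (form A v y + form A y y) * + 4
      L≡v+2y = trans (form-cong A L≗ L≗) (form-+2·-diag v y)
        where
        L≗ : lift x ≗ v +ᵥ + 2 ·ᵥ y
        L≗ i = trans (cong bit (sym (v≈x i))) (proj₂ (lift∘red v) i)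
      4∣vv-LL : + 4 ∣ form A v v - form A (lift x) (lift x)
      4∣vv-LL = subst (λ z → + 4 ∣ form A v v - z) (sym L≡v+2y)
        (subst (+ 4 ∣_) (cancel (form A v v) (form A v y + form A y y))
          (∣m⇒∣-m (divides (form A v y + form A y y) refl)))
        where
        cancel : ∀ a c → - (c * + 4) ≡ a - (a + c * + 4)
        cancel = solve-∀
      2∣LL : + 2 ∣ form A (lift x) (lift x)
      2∣LL = subst (+ 2 ∣_) (sym L≡v+2y)
        (∣m∣n⇒∣m+n (2∣form {v} v∈V₀ v) (∣n⇒∣m*n (form A v y + form A y y) (divides (+ 2) refl)))

    V̄0-0̄ : V̄0 A 0̄
    V̄0-0̄ = (λ _ → 0ℤ) , (λ w → ∣⇒∣ᵤ {k = + 2} (divides 0ℤ (Σℤ-0 {n}))) , (λ _ → refl)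

    V̄0-⊕ : ∀ {x y} → V̄0 A x → V̄0 A y → V̄0 A (x ⊕ y)
    V̄0-⊕ (v , v∈V₀ , v≈x) (w , w∈V₀ , w≈y) =
      v +ᵥ w , InV0-+ {v} {w} v∈V₀ w∈V₀ ,
      λ i → trans (red-+ᵥ v w i) (cong₂ _xor_ (v≈x i) (w≈y i))

    q-⊕ : ∀ {x y} → V̄0 A x → V̄0 A y → q A (x ⊕ y) ≡ q A x xor q A y
    q-⊕ (v , v∈V₀ , v≈x) (w , w∈V₀ , w≈y) = HalfParity-unique
      (q-halfParity (v +ᵥ w) (InV0-+ {v} {w} v∈V₀ w∈V₀)
        (λ i → trans (red-+ᵥ v w i) (cong₂ _xor_ (v≈x i) (w≈y i))))
      (HalfParity-resp 4∣cross (HalfParity-+ (q-halfParity v v∈V₀ v≈x) (q-halfParity w w∈V₀ w≈y)))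
      where
      cancel : ∀ a b c → + 2 * b ≡ a + + 2 * b + c - (a + c)
      cancel = solve-∀
      4∣cross : + 4 ∣ form A (v +ᵥ w) (v +ᵥ w) - (form A v v + form A w w)
      4∣cross = subst (+ 4 ∣_)
        (trans (cancel (form A v v) (form A v w) (form A w w))
               (cong (_- (form A v v + form A w w)) (sym (form-+ᵥ-diag v w))))
        (*-monoʳ-∣ (+ 2) (2∣form {v} v∈V₀ w))

    V̄00-resp : ∀ {x y} → x ≈ y → V̄00 A x → V̄00 A y
    V̄00-resp x≈y (v , v∈V₀₀ , v≈x) = v , v∈V₀₀ , ≈-trans v≈x x≈y

    q-0̄ : q A 0̄ ≡ false
    q-0̄ = trans (q-⊕ V̄0-0̄ V̄0-0̄) (Bool.xor-same (q A 0̄))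

    q-cong : ∀ {x y} → x ≈ y → q A x ≡ q A y
    q-cong x≈y = cong (λ X → parity (X /ℕ 2)) (form-cong A lift≗ lift≗)
      where
      lift≗ = λ i → cong bit (x≈y i)

    V̄00⇔V̄0×q≡false : ∀ {x} → V̄00 A x ⇔ (V̄0 A x × q A x ≡ false)
    V̄00⇔V̄0×q≡false = mk⇔
      (λ { (v , (v∈V₀ , 4∣vv) , v≈x) → (v , v∈V₀ , v≈x) ,
           HalfParity-unique (q-halfParity v v∈V₀ v≈x)
             (4∣⇒HalfParity-false (∣ᵤ⇒∣ {i = form A v v} 4∣vv)) })
      (λ { ((v , v∈V₀ , v≈x) , q≡false) →
           v , (v∈V₀ , ∣⇒∣ᵤ (HalfParity-false⇒4∣
                              (subst (HalfParity (form A v v)) q≡false (q-halfParity v v∈V₀ v≈x)))) ,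
           v≈x })

    V̄0-comb₂ : ∀ {k} (c : Fin k → Bool) {u : Fin k → V̄ n} →
      (∀ j → V̄0 A (u j)) → V̄0 A (comb₂ c u)
    V̄0-comb₂ {ℕ.zero}  c u∈V̄₀ = V̄0-0̄
    V̄0-comb₂ {ℕ.suc k} c u∈V̄₀ with c zero
    ... | true  = V̄0-⊕ (u∈V̄₀ zero) (V̄0-comb₂ (c ∘ suc) (u∈V̄₀ ∘ suc))
    ... | false = V̄0-comb₂ (c ∘ suc) (u∈V̄₀ ∘ suc)

    q-comb₂ : ∀ {k} (c : Fin k → Bool) {u : Fin k → V̄ n} → (∀ j → V̄0 A (u j)) →
      q A (comb₂ c u) ≡ Σ₂ (λ j → c j ∧ q A (u j))
    q-comb₂ {ℕ.zero}  c u∈V̄₀ = q-0̄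
    q-comb₂ {ℕ.suc k} c {u} u∈V̄₀ with c zero
    ... | true  = trans (q-⊕ (u∈V̄₀ zero) (V̄0-comb₂ (c ∘ suc) (u∈V̄₀ ∘ suc)))
                        (cong (q A (u zero) xor_) (q-comb₂ (c ∘ suc) (u∈V̄₀ ∘ suc)))
    ... | false = q-comb₂ (c ∘ suc) (u∈V̄₀ ∘ suc)

  combℤ-- : ∀ {k n} (c d : Fin k → ℤ) (b : Fin k → Vecℤ n) →
    ∀ i → combℤ (λ l → c l - d l) b i ≡ combℤ c b i - combℤ d b i
  combℤ-- c d b i = trans (Σℤ-cong (λ l → distrib (c l) (d l) (b l i)))
    (Σℤ-- (λ l → c l * b l i) (λ l → d l * b l i))
    where
    distrib : ∀ x y z → (x - y) * z ≡ x * z - y * z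
    distrib = solve-∀

  combℤ-*ʳ : ∀ {k n} (d : Fin k → ℤ) (a : ℤ) (b : Fin k → Vecℤ n) →
    ∀ i → combℤ (λ l → d l * a) b i ≡ combℤ d b i * a
  combℤ-*ʳ d a b i = trans (Σℤ-cong (λ l → reorder (d l) a (b l i)))
    (trans (Σℤ-*ˡ a (λ l → d l * b l i)) (ℤ.*-comm a (combℤ d b i)))
    where
    reorder : ∀ x a z → x * a * z ≡ a * (x * z)
    reorder = solve-∀

  module ReducedBasis {n} (b : Fin n → Vecℤ n) (b-basis : IsZBasis b) where

    coords : Vecℤ n → Fin n → ℤ
    coords v = proj₁ (proj₁ b-basis v)

    combℤ-coords : ∀ v → combℤ (coords v) b ≗ v
    combℤ-coords v = proj₂ (proj₁ b-basis v)

    red≈comb₂-coords : ∀ v → red v ≈ comb₂ (parity ∘ coords v) (red ∘ b)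
    red≈comb₂-coords v = ≈-trans (λ i → cong parity (sym (combℤ-coords v i))) (red-combℤ (coords v) b)

    combℤ-injective : ∀ c d → combℤ c b ≗ combℤ d b → c ≗ d
    combℤ-injective c d c≗d l =
      ℤ.i-j≡0⇒i≡j (c l) (d l) (proj₂ b-basis (λ l → c l - d l) difference≡0 l)
      where
      difference≡0 : ∀ i → combℤ (λ l → c l - d l) b i ≡ 0ℤ
      difference≡0 i = trans (combℤ-- c d b i)
        (trans (cong (_-_ (combℤ c b i)) (sym (c≗d i))) (ℤ.+-inverseʳ (combℤ c b i)))

    red-linIndep : LinIndep₂ (red ∘ b)
    red-linIndep c comb≈0 l = begin
      c l
        ≡⟨ sym (parity-bit (c l)) ⟩
      parity (bit (c l))
        ≡⟨ cong parity (combℤ-injective (bit ∘ c) (λ l → coords y l * + 2) v≗2y l) ⟩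
      parity (coords y l * + 2)
        ≡⟨ 2∣⇒parity≡false (divides (coords y l) refl) ⟩
      false ∎
      where
      open _∣_
      v = combℤ (bit ∘ c) b
      v-even : ∀ i → + 2 ∣ v i
      v-even i = parity≡false⇒2∣ (trans (red-combℤ (bit ∘ c) b i)
        (trans (comb₂-cong {u = red ∘ b} (parity-bit ∘ c) (λ _ _ → refl) i) (comb≈0 i)))
      y : Vecℤ n
      y i = quotient (v-even i)
      v≗2y : v ≗ combℤ (λ l → coords y l * + 2) b
      v≗2y i = begin
        v i                            ≡⟨ equality (v-even i) ⟩
        y i * + 2                      ≡⟨ cong (_* + 2) (sym (combℤ-coords y i)) ⟩
        combℤ (coords y) b i * + 2     ≡⟨ sym (combℤ-*ʳ (coords y) (+ 2) b i) ⟩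
        combℤ (λ l → coords y l * + 2) b i ∎

  -- A basis whose Gram matrix is known modulo 4

  module GramMod4 {n} (A : Mat n) (A-sym : Symmetric A) (b : Fin n → Vecℤ n) (b-basis : IsZBasis b)
    (T : Mat n) (gram : ∀ i j → form A (b i) (b j) ≡mod4 T i j) where

    open ReducedBasis b b-basis
    open QuadraticRefinement A A-sym

    form-basisʳ-mod4 : ∀ v k → + 4 ∣ form A v (b k) - Σℤ (λ l → coords v l * T l k)
    form-basisʳ-mod4 v k = subst (+ 4 ∣_) sum≡ (∣Σℤ (λ l → ∣n⇒∣m*n (coords v l) (4∣gram l)))
      where
      G : Fin n → ℤ
      G l = form A (b l) (b k)
      4∣gram : ∀ l → + 4 ∣ G l - T l k
      4∣gram l = ∣ᵤ⇒∣ {i = G l - T l k} (gram l k)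
      distrib : ∀ x y z → x * (y - z) ≡ x * y - x * z
      distrib = solve-∀
      sum≡ : Σℤ (λ l → coords v l * (G l - T l k)) ≡ form A v (b k) - Σℤ (λ l → coords v l * T l k)
      sum≡ = begin
        Σℤ (λ l → coords v l * (G l - T l k))
          ≡⟨ Σℤ-cong (λ l → distrib (coords v l) (G l) (T l k)) ⟩
        Σℤ (λ l → coords v l * G l - coords v l * T l k)
          ≡⟨ Σℤ-- (λ l → coords v l * G l) (λ l → coords v l * T l k) ⟩
        Σℤ (λ l → coords v l * G l) - Σℤ (λ l → coords v l * T l k)
          ≡⟨ cong (_- Σℤ (λ l → coords v l * T l k))
                  (sym (trans (form-cong A (sym ∘ combℤ-coords v) (λ _ → refl))
                              (form-combℤˡ A (coords v) b (b k)))) ⟩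
        form A v (b k) - Σℤ (λ l → coords v l * T l k) ∎

    ∣form-basisʳ : ∀ {M} → M ∣ + 4 → ∀ k → (∀ l → M ∣ T l k) → ∀ v → M ∣ form A v (b k)
    ∣form-basisʳ {M} M∣4 k M∣T v = subst (M ∣_) (rearrange (form A v (b k)) _)
      (∣m∣n⇒∣m+n (∣-trans M∣4 (form-basisʳ-mod4 v k)) (∣Σℤ (λ l → ∣n⇒∣m*n (coords v l) (M∣T l))))
      where
      rearrange : ∀ a s → a - s + s ≡ a
      rearrange = solve-∀

    ∣coords*T : ∀ {M} → M ∣ + 4 → ∀ l₀ k → (∀ l → l ≢ l₀ → M ∣ T l k) →
      ∀ v → M ∣ form A v (b k) → M ∣ coords v l₀ * T l₀ k
    ∣coords*T {M} M∣4 l₀ k M∣T v M∣form = subst (M ∣_) (rearrange S (coords v l₀ * T l₀ k))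
      (∣m∣n⇒∣m-n M∣S (∣Σℤ-minus-term (λ l → coords v l * T l k) l₀
                                     (λ l l≢l₀ → ∣n⇒∣m*n (coords v l) (M∣T l l≢l₀))))
      where
      S = Σℤ (λ l → coords v l * T l k)
      rearrange : ∀ s t → s - (s - t) ≡ t
      rearrange = solve-∀
      M∣S : M ∣ S
      M∣S = subst (M ∣_) (rearrange (form A v (b k)) S)
        (∣m∣n⇒∣m-n M∣form (∣-trans M∣4 (form-basisʳ-mod4 v k)))

    column-even⇒InV0 : ∀ k → (∀ l → + 2 ∣ T l k) → InV0 A (b k)
    column-even⇒InV0 k 2∣T w =
      ∣⇒∣ᵤ (subst (+ 2 ∣_) (form-comm A A-sym w (b k)) (∣form-basisʳ (divides (+ 2) refl) k 2∣T w))

    column-4∣⇒InV000 : ∀ k → (∀ l → + 4 ∣ T l k) → InV000 A (b k)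
    column-4∣⇒InV000 k 4∣T =
      column-even⇒InV0 k (λ l → ∣-trans (divides (+ 2) refl) (4∣T l)) ,
      λ w → ∣⇒∣ᵤ (subst (+ 4 ∣_) (form-comm A A-sym w (b k))
                       (∣form-basisʳ (divides (+ 1) refl) k 4∣T w))

    q-red-basis : ∀ k {β} → InV0 A (b k) → T k k ≡ bit β * + 2 → q A (red (b k)) ≡ β
    q-red-basis k b∈V₀ T≡2β = HalfParity-unique (q-halfParity (b k) b∈V₀ (λ _ → refl))
      (halfParity (subst (λ t → + 4 ∣ form A (b k) (b k) - t) T≡2β
        (∣ᵤ⇒∣ {i = form A (b k) (b k) - T k k} (gram k k))))

  module Positions (r s t p m : ℕ) where

    open Layout r s t p m

    unpos : Pos → Fin n
    unpos (pE i)   = eI i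
    unpos (pF i)   = fI i
    unpos (pG i β) = gI (combine i β)
    unpos (pA j)   = aI j
    unpos (pH j)   = hI j

    pos∘unpos : ∀ P → pos (unpos P) ≡ P
    pos∘unpos (pE i) rewrite Fin.splitAt-↑ˡ N₁ (combine {r ℕ.+ s} {2} i zero) (N₂ ℕ.+ (p ℕ.+ m))
                          | Fin.remQuot-combine {r ℕ.+ s} {2} i zero = refl
    pos∘unpos (pF i) rewrite Fin.splitAt-↑ˡ N₁ (combine {r ℕ.+ s} {2} i (suc zero)) (N₂ ℕ.+ (p ℕ.+ m))
                          | Fin.remQuot-combine {r ℕ.+ s} {2} i (suc zero) = refl
    pos∘unpos (pG i β) rewrite Fin.splitAt-↑ʳ N₁ (N₂ ℕ.+ (p ℕ.+ m)) (combine i β ↑ˡ (p ℕ.+ m))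
                            | Fin.splitAt-↑ˡ N₂ (combine {t} {2} i β) (p ℕ.+ m) =
      cong (λ (i , β) → pG i β) (Fin.remQuot-combine {t} {2} i β)
    pos∘unpos (pA j) rewrite Fin.splitAt-↑ʳ N₁ (N₂ ℕ.+ (p ℕ.+ m)) (N₂ ↑ʳ (j ↑ˡ m))
                          | Fin.splitAt-↑ʳ N₂ (p ℕ.+ m) (j ↑ˡ m)
                          | Fin.splitAt-↑ˡ p j m = refl
    pos∘unpos (pH j) rewrite Fin.splitAt-↑ʳ N₁ (N₂ ℕ.+ (p ℕ.+ m)) (N₂ ↑ʳ (p ↑ʳ j))
                          | Fin.splitAt-↑ʳ N₂ (p ℕ.+ m) (p ↑ʳ j)
                          | Fin.splitAt-↑ʳ p m j = refl

    unpos∘pos : ∀ l → unpos (pos l) ≡ l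
    unpos∘pos l with splitAt N₁ l in eq₁
    ... | inj₁ k with remQuot {r ℕ.+ s} 2 k in eq₂
    ...   | (i , zero)     =
      trans (cong (_↑ˡ (N₂ ℕ.+ (p ℕ.+ m))) (combine-remQuot⁻¹ eq₂)) (Fin.splitAt⁻¹-↑ˡ eq₁)
    ...   | (i , suc zero) =
      trans (cong (_↑ˡ (N₂ ℕ.+ (p ℕ.+ m))) (combine-remQuot⁻¹ eq₂)) (Fin.splitAt⁻¹-↑ˡ eq₁)
    unpos∘pos l | inj₂ k with splitAt N₂ k in eq₂
    ...   | inj₁ g = trans (cong (λ g → N₁ ↑ʳ (g ↑ˡ (p ℕ.+ m))) (Fin.combine-remQuot {t} 2 g))
                           (trans (cong (N₁ ↑ʳ_) (Fin.splitAt⁻¹-↑ˡ eq₂)) (Fin.splitAt⁻¹-↑ʳ eq₁))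
    unpos∘pos l | inj₂ k | inj₂ h with splitAt p h in eq₃
    ...     | inj₁ j = trans (cong (λ h → N₁ ↑ʳ (N₂ ↑ʳ h)) (Fin.splitAt⁻¹-↑ˡ eq₃))
                             (trans (cong (N₁ ↑ʳ_) (Fin.splitAt⁻¹-↑ʳ eq₂)) (Fin.splitAt⁻¹-↑ʳ eq₁))
    ...     | inj₂ j = trans (cong (λ h → N₁ ↑ʳ (N₂ ↑ʳ h)) (Fin.splitAt⁻¹-↑ʳ eq₃))
                             (trans (cong (N₁ ↑ʳ_) (Fin.splitAt⁻¹-↑ʳ eq₂)) (Fin.splitAt⁻¹-↑ʳ eq₁))

    column-except : ∀ {M} P₀ Q → (∀ P → P ≢ P₀ → M ∣ entry P Q) →
      ∀ l → l ≢ unpos P₀ → M ∣ gramTarget l (unpos Q)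
    column-except P₀ Q M∣entry l l≢P₀ rewrite pos∘unpos Q =
      M∣entry (pos l) (λ pos≡P₀ → l≢P₀ (trans (sym (unpos∘pos l)) (cong unpos pos≡P₀)))

    column : ∀ {M} Q → (∀ P → M ∣ entry P Q) → ∀ l → M ∣ gramTarget l (unpos Q)
    column Q M∣entry l rewrite pos∘unpos Q = M∣entry (pos l)

    gramTarget-unpos : ∀ P Q → gramTarget (unpos P) (unpos Q) ≡ entry P Q
    gramTarget-unpos P Q = cong₂ entry (pos∘unpos P) (pos∘unpos Q)

    private
      ∣0 : ∀ {M} → M ∣ 0ℤ
      ∣0 = divides 0ℤ refl

      2∣if : ∀ β → + 2 ∣ (if β then + 2 else 0ℤ)
      2∣if false = ∣0
      2∣if true  = divides (+ 1) refl

      eqF-refl : ∀ {k} (i : Fin k) → eqF i i ≡ true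
      eqF-refl i = dec-true (i Fin.≟ i) refl

    e-f-entry : ∀ i → entry (pE i) (pF i) ≡ + 1
    e-f-entry i rewrite eqF-refl i = refl

    f-e-entry : ∀ i → entry (pF i) (pE i) ≡ + 1
    f-e-entry i rewrite eqF-refl i = refl

    f-column-even-off-e : ∀ i P → P ≢ pE i → + 2 ∣ entry P (pF i)
    f-column-even-off-e i (pE i′) P≢ with i′ Fin.≟ i
    ... | yes refl = ⊥-elim (P≢ refl)
    ... | no _     = ∣0
    f-column-even-off-e i (pF _)   _ = 2∣if _
    f-column-even-off-e i (pG _ _) _ = ∣0
    f-column-even-off-e i (pA _)   _ = ∣0
    f-column-even-off-e i (pH _)   _ = ∣0

    e-column-even-off-f : ∀ i P → P ≢ pF i → + 2 ∣ entry P (pE i)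
    e-column-even-off-f i (pF i′) P≢ with i′ Fin.≟ i
    ... | yes refl = ⊥-elim (P≢ refl)
    ... | no _     = ∣0
    e-column-even-off-f i (pE _)   _ = 2∣if _
    e-column-even-off-f i (pG _ _) _ = ∣0
    e-column-even-off-f i (pA _)   _ = ∣0
    e-column-even-off-f i (pH _)   _ = ∣0

    g-g′-entry : ∀ i β → entry (pG i β) (pG i (opposite β)) ≡ + 2
    g-g′-entry i zero       rewrite eqF-refl i = refl
    g-g′-entry i (suc zero) rewrite eqF-refl i = refl

    g-column-4∣-off-g : ∀ i β P → P ≢ pG i β → + 4 ∣ entry P (pG i (opposite β))
    g-column-4∣-off-g i β (pG i′ γ) P≢ with i′ Fin.≟ i
    ... | no _ = ∣0
    ... | yes refl with γ | β
    ...   | zero     | zero     = ⊥-elim (P≢ refl)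
    ...   | suc zero | suc zero = ⊥-elim (P≢ refl)
    ...   | zero     | suc zero = ∣0
    ...   | suc zero | zero     = ∣0
    g-column-4∣-off-g i β (pE _) _ = ∣0
    g-column-4∣-off-g i β (pF _) _ = ∣0
    g-column-4∣-off-g i β (pA _) _ = ∣0
    g-column-4∣-off-g i β (pH _) _ = ∣0

    g-column-even : ∀ i β P → + 2 ∣ entry P (pG i β)
    g-column-even i β (pG _ _) = 2∣if _
    g-column-even i β (pE _)   = ∣0
    g-column-even i β (pF _)   = ∣0
    g-column-even i β (pA _)   = ∣0
    g-column-even i β (pH _)   = ∣0

    g-diagonal : ∀ i β → entry (pG i β) (pG i β) ≡ 0ℤ
    g-diagonal i β rewrite eqF-refl i | eqF-refl β = refl

    a-diagonal : ∀ j → entry (pA j) (pA j) ≡ + 2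
    a-diagonal j rewrite eqF-refl j = refl

    a-column-4∣-off-a : ∀ j P → P ≢ pA j → + 4 ∣ entry P (pA j)
    a-column-4∣-off-a j (pA j′) P≢ with j′ Fin.≟ j
    ... | yes refl = ⊥-elim (P≢ refl)
    ... | no _     = ∣0
    a-column-4∣-off-a j (pE _)   _ = ∣0
    a-column-4∣-off-a j (pF _)   _ = ∣0
    a-column-4∣-off-a j (pG _ _) _ = ∣0
    a-column-4∣-off-a j (pH _)   _ = ∣0

    a-column-even : ∀ j P → + 2 ∣ entry P (pA j)
    a-column-even j (pA _)   = 2∣if _
    a-column-even j (pE _)   = ∣0
    a-column-even j (pF _)   = ∣0
    a-column-even j (pG _ _) = ∣0
    a-column-even j (pH _)   = ∣0

    h-column≡0 : ∀ j P → entry P (pH j) ≡ 0ℤ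
    h-column≡0 j (pE _)   = refl
    h-column≡0 j (pF _)   = refl
    h-column≡0 j (pG _ _) = refl
    h-column≡0 j (pA _)   = refl
    h-column≡0 j (pH _)   = refl

  module AdaptedBasis (r s t p m : ℕ) (A : Mat (Layout.n r s t p m)) (A-sym : Symmetric A)
    (b : Fin (Layout.n r s t p m) → Vecℤ (Layout.n r s t p m)) (b-basis : IsZBasis b)
    (gram : ∀ i j → form A (b i) (b j) ≡mod4 Layout.gramTarget r s t p m i j) where

    open Layout r s t p m
    open Fam b
    open Positions r s t p m
    open ReducedBasis b b-basis
    open GramMod4 A A-sym b b-basis gramTarget gram
    open QuadraticRefinement A A-sym

    ∣coords-at : ∀ {M} c → M ∣ + 4 → ∀ P₀ Q → entry P₀ Q ≡ c → (∀ P → P ≢ P₀ → M ∣ entry P Q) →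
      ∀ v → M ∣ form A v (b (unpos Q)) → M ∣ coords v (unpos P₀) * c
    ∣coords-at {M} c M∣4 P₀ Q entry≡c M∣column v M∣form =
      subst (λ c → M ∣ coords v (unpos P₀) * c) (trans (gramTarget-unpos P₀ Q) entry≡c)
        (∣coords*T M∣4 (unpos P₀) (unpos Q) (column-except P₀ Q M∣column) v M∣form)

    parity-coords-e : ∀ {v} → InV0 A v → ∀ i → parity (coords v (eI i)) ≡ false
    parity-coords-e {v} v∈V₀ i = 2∣⇒parity≡false (subst (+ 2 ∣_) (ℤ.*-identityʳ (coords v (eI i)))
      (∣coords-at (+ 1) (divides (+ 2) refl) (pE i) (pF i) (e-f-entry i) (f-column-even-off-e i)
                  v (∣ᵤ⇒∣ (v∈V₀ (b (fI i))))))

    parity-coords-f : ∀ {v} → InV0 A v → ∀ i → parity (coords v (fI i)) ≡ false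
    parity-coords-f {v} v∈V₀ i = 2∣⇒parity≡false (subst (+ 2 ∣_) (ℤ.*-identityʳ (coords v (fI i)))
      (∣coords-at (+ 1) (divides (+ 2) refl) (pF i) (pE i) (f-e-entry i) (e-column-even-off-f i)
                  v (∣ᵤ⇒∣ (v∈V₀ (b (eI i))))))

    parity-coords-ef : ∀ {v} → InV0 A v → ∀ k → parity (coords v (k ↑ˡ (N₂ ℕ.+ (p ℕ.+ m)))) ≡ false
    parity-coords-ef v∈V₀ k with Fin.combine-surjective {r ℕ.+ s} {2} k
    ... | i , zero     , refl = parity-coords-e v∈V₀ i
    ... | i , suc zero , refl = parity-coords-f v∈V₀ i

    private
      4∣*2⇒parity≡false : ∀ {x} → + 4 ∣ x * + 2 → parity x ≡ false
      4∣*2⇒parity≡false {x} 4∣2x = 2∣⇒parity≡false (*-cancelʳ-∣ (+ 2) {+ 2} {x} 4∣2x)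

    parity-coords-g : ∀ {v} → InV000 A v → ∀ k → parity (coords v (gI k)) ≡ false
    parity-coords-g {v} (_ , v∈V₀₀₀) k with Fin.combine-surjective {t} {2} k
    ... | i , β , refl = 4∣*2⇒parity≡false {coords v (gI (combine i β))}
      (∣coords-at (+ 2) (divides (+ 1) refl) (pG i β) (pG i (opposite β)) (g-g′-entry i β) (g-column-4∣-off-g i β)
                  v (∣ᵤ⇒∣ (v∈V₀₀₀ (b (gI (combine i (opposite β)))))))

    parity-coords-a : ∀ {v} → InV000 A v → ∀ j → parity (coords v (aI j)) ≡ false
    parity-coords-a {v} (_ , v∈V₀₀₀) j = 4∣*2⇒parity≡false {coords v (aI j)}
      (∣coords-at (+ 2) (divides (+ 1) refl) (pA j) (pA j) (a-diagonal j) (a-column-4∣-off-a j)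
                  v (∣ᵤ⇒∣ (v∈V₀₀₀ (b (aI j)))))

    b-g∈V0 : ∀ k → InV0 A (b (gI k))
    b-g∈V0 k with Fin.combine-surjective {t} {2} k
    ... | i , β , refl = column-even⇒InV0 (gI (combine i β)) (column (pG i β) (g-column-even i β))

    b-a∈V0 : ∀ j → InV0 A (b (aI j))
    b-a∈V0 j = column-even⇒InV0 (aI j) (column (pA j) (a-column-even j))

    b-h∈V000 : ∀ j → InV000 A (b (hI j))
    b-h∈V000 j = column-4∣⇒InV000 (hI j) (column (pH j) (λ P → divides 0ℤ (h-column≡0 j P)))

    ḡ∈V̄0 : ∀ k → V̄0 A (ḡ k)
    ḡ∈V̄0 k = b (gI k) , b-g∈V0 k , (λ _ → refl)

    ā∈V̄0 : ∀ j → V̄0 A (ā j)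
    ā∈V̄0 j = b (aI j) , b-a∈V0 j , (λ _ → refl)

    h̄∈V̄000 : ∀ j → V̄000 A (h̄ j)
    h̄∈V̄000 j = b (hI j) , b-h∈V000 j , (λ _ → refl)

    h̄∈V̄0 : ∀ j → V̄0 A (h̄ j)
    h̄∈V̄0 j = b (hI j) , proj₁ (b-h∈V000 j) , (λ _ → refl)

    q-ḡ : ∀ k → q A (ḡ k) ≡ false
    q-ḡ k with Fin.combine-surjective {t} {2} k
    ... | i , β , refl = q-red-basis (gI (combine i β)) (b-g∈V0 (combine i β))
      (trans (gramTarget-unpos (pG i β) (pG i β)) (g-diagonal i β))

    q-ā : ∀ j → q A (ā j) ≡ true
    q-ā j = q-red-basis (aI j) (b-a∈V0 j) (trans (gramTarget-unpos (pA j) (pA j)) (a-diagonal j))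

    q-h̄ : ∀ j → q A (h̄ j) ≡ false
    q-h̄ j = q-red-basis (hI j) (proj₁ (b-h∈V000 j))
      (trans (gramTarget-unpos (pH j) (pH j)) (h-column≡0 j (pH j)))

    u : Fin (N₂ ℕ.+ (p ℕ.+ m)) → V̄ n
    u = ḡ ++ (ā ++ h̄)

    u∈V̄0 : ∀ j → V̄0 A (u j)
    u∈V̄0 = ∀-++ {P = V̄0 A} ḡ∈V̄0 (∀-++ {P = V̄0 A} ā∈V̄0 h̄∈V̄0)

    u≡red-b : ∀ j → u j ≡ red (b (N₁ ↑ʳ j))
    u≡red-b = ↑-elim (lookup-++ˡ ḡ (ā ++ h̄))
      (λ j → trans (lookup-++ʳ ḡ (ā ++ h̄) j) (↑-elim {p} (lookup-++ˡ ā h̄) (lookup-++ʳ ā h̄) j))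

    u-linIndep : LinIndep₂ u
    u-linIndep = LinIndep₂-resp (λ j → cong-app (sym (u≡red-b j))) (LinIndep₂-drop N₁ red-linIndep)

    u-coords : Vecℤ n → Fin (N₂ ℕ.+ (p ℕ.+ m)) → Bool
    u-coords v = drop N₁ (parity ∘ coords v)

    comb₂-u-coords : ∀ {v} → InV0 A v → comb₂ (u-coords v) u ≈ red v
    comb₂-u-coords {v} v∈V₀ i = begin
      comb₂ (u-coords v) u i
        ≡⟨ comb₂-cong (λ _ → refl) (λ j → cong-app (u≡red-b j)) i ⟩
      comb₂ (u-coords v) (drop N₁ B) i
        ≡⟨ cong (_xor comb₂ (u-coords v) (drop N₁ B) i)
                (sym (comb₂-false (take N₁ B) (parity-coords-ef v∈V₀) i)) ⟩
      comb₂ (take N₁ (parity ∘ coords v)) (take N₁ B) i xor comb₂ (u-coords v) (drop N₁ B) i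
        ≡⟨ sym (comb₂-splitAt N₁ (parity ∘ coords v) B i) ⟩
      comb₂ (parity ∘ coords v) B i
        ≡⟨ sym (red≈comb₂-coords v i) ⟩
      red v i ∎
      where
      B = red ∘ b

    comb₂-u : ∀ c →
      comb₂ c u ≈ (comb₂ (take N₂ c) ḡ ⊕ (comb₂ (take p (drop N₂ c)) ā ⊕ comb₂ (drop p (drop N₂ c)) h̄))
    comb₂-u c = comb₂-++₃ c ḡ ā h̄

    q-comb₂-u : ∀ c → q A (comb₂ c u) ≡ Σ₂ (take p (drop N₂ c))
    q-comb₂-u c = begin
      q A (comb₂ c u)
        ≡⟨ q-cong (comb₂-u c) ⟩
      q A (comb₂ cg ḡ ⊕ (comb₂ ca ā ⊕ comb₂ ch h̄))
        ≡⟨ q-⊕ (V̄0-comb₂ cg ḡ∈V̄0) (V̄0-⊕ (V̄0-comb₂ ca ā∈V̄0) (V̄0-comb₂ ch h̄∈V̄0)) ⟩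
      q A (comb₂ cg ḡ) xor q A (comb₂ ca ā ⊕ comb₂ ch h̄)
        ≡⟨ cong (q A (comb₂ cg ḡ) xor_) (q-⊕ (V̄0-comb₂ ca ā∈V̄0) (V̄0-comb₂ ch h̄∈V̄0)) ⟩
      q A (comb₂ cg ḡ) xor (q A (comb₂ ca ā) xor q A (comb₂ ch h̄))
        ≡⟨ cong₂ (λ x y → x xor (y xor q A (comb₂ ch h̄)))
                 (trans (q-comb₂ cg ḡ∈V̄0) (Σ₂-∧-false cg q-ḡ))
                 (trans (q-comb₂ ca ā∈V̄0) (Σ₂-∧-true ca q-ā)) ⟩
      Σ₂ ca xor q A (comb₂ ch h̄)
        ≡⟨ cong (Σ₂ ca xor_) (trans (q-comb₂ ch h̄∈V̄0) (Σ₂-∧-false ch q-h̄)) ⟩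
      Σ₂ ca xor false
        ≡⟨ Bool.xor-identityʳ (Σ₂ ca) ⟩
      Σ₂ ca ∎
      where
      cg = take N₂ c
      ca = take p (drop N₂ c)
      ch = drop p (drop N₂ c)

    record Coordinates (x : V̄ n) : Set where
      field
        coeff : Fin (N₂ ℕ.+ (p ℕ.+ m)) → Bool
        comb₂≈ : comb₂ coeff u ≈ x
        q≡Σ₂ : q A x ≡ Σ₂ (take p (drop N₂ coeff))

    V̄0-coordinates : ∀ {x} → V̄0 A x → Coordinates x
    V̄0-coordinates (v , v∈V₀ , v≈x) = record
      { coeff  = u-coords v
      ; comb₂≈ = c≈x
      ; q≡Σ₂   = trans (q-cong (≈-sym c≈x)) (q-comb₂-u (u-coords v))
      }
      where
      c≈x = ≈-trans (comb₂-u-coords v∈V₀) v≈x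

    u-basis : IsBasisOf (V̄0 A) u
    u-basis = u∈V̄0 , u-linIndep ,
      λ x x∈V̄₀ → let open Coordinates (V̄0-coordinates x∈V̄₀) in coeff , comb₂≈

    h̄-basis : IsBasisOf (V̄000 A) h̄
    h̄-basis = h̄∈V̄000 , h̄-linIndep , h̄-spans
      where
      h̄-linIndep : LinIndep₂ h̄
      h̄-linIndep = LinIndep₂-resp
        (λ j → cong-app (trans (lookup-++ʳ ḡ (ā ++ h̄) (p ↑ʳ j)) (lookup-++ʳ ā h̄ j)))
        (LinIndep₂-drop p (LinIndep₂-drop N₂ u-linIndep))
      h̄-spans : ∀ x → V̄000 A x → ∃ λ c → comb₂ c h̄ ≈ x
      h̄-spans x (v , v∈V₀₀₀ , v≈x) = drop p (drop N₂ c) , λ i → begin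
        comb₂ (drop p (drop N₂ c)) h̄ i
          ≡⟨ sym (cong₂ (λ y z → y xor (z xor comb₂ (drop p (drop N₂ c)) h̄ i))
                        (comb₂-false ḡ (parity-coords-g v∈V₀₀₀) i)
                        (comb₂-false ā (parity-coords-a v∈V₀₀₀) i)) ⟩
        (comb₂ (take N₂ c) ḡ ⊕ (comb₂ (take p (drop N₂ c)) ā ⊕ comb₂ (drop p (drop N₂ c)) h̄)) i
          ≡⟨ sym (comb₂-u c i) ⟩
        comb₂ c u i
          ≡⟨ comb₂-u-coords (proj₁ v∈V₀₀₀) i ⟩
        red v i
          ≡⟨ v≈x i ⟩
        x i ∎
        where
        c = u-coords v

    u-independent : ∀ cg ca ch → (comb₂ cg ḡ ⊕ (comb₂ ca ā ⊕ comb₂ ch h̄)) ≈ 0̄ →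
      (∀ k → cg k ≡ false) × (∀ j → ca j ≡ false) × (∀ j → ch j ≡ false)
    u-independent cg ca ch comb≈0 =
      (λ k → trans (sym (lookup-++ˡ cg (ca ++ ch) k)) (c≡false (k ↑ˡ (p ℕ.+ m)))) ,
      (λ j → trans (sym (trans (lookup-++ʳ cg (ca ++ ch) (j ↑ˡ m)) (lookup-++ˡ ca ch j)))
                   (c≡false (N₂ ↑ʳ (j ↑ˡ m)))) ,
      (λ j → trans (sym (trans (lookup-++ʳ cg (ca ++ ch) (p ↑ʳ j)) (lookup-++ʳ ca ch j)))
                   (c≡false (N₂ ↑ʳ (p ↑ʳ j))))
      where
      c≡false = u-linIndep (cg ++ (ca ++ ch)) (≈-trans (comb₂-++-++₃ cg ca ch ḡ ā h̄) comb≈0)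

    V̄00-trivial : p ℕ.≤ 1 → t ℕ.* 2 ℕ.+ m ≡ 0 → ∀ {x} → V̄00 A x → x ≈ 0̄
    V̄00-trivial p≤1 N₂+m≡0 {x} x∈V̄₀₀ i = begin
      x i                ≡⟨ sym (comb₂≈ i) ⟩
      comb₂ coeff u i    ≡⟨ comb₂-u coeff i ⟩
      comb₂ (take N₂ coeff) ḡ i
        xor (comb₂ (take p (drop N₂ coeff)) ā i xor comb₂ (drop p (drop N₂ coeff)) h̄ i)
        ≡⟨ cong₂ _xor_ (comb₂-empty ḡ (ℕ.m+n≡0⇒m≡0 N₂ N₂+m≡0) i)
                       (cong₂ _xor_ (comb₂-single ā p≤1 (trans (sym q≡Σ₂) qx≡false) i)
                                    (comb₂-empty h̄ (ℕ.m+n≡0⇒n≡0 N₂ N₂+m≡0) i)) ⟩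
      false              ∎
      where
      open Equivalence
      qx≡false = proj₂ (to V̄00⇔V̄0×q≡false x∈V̄₀₀)
      open Coordinates (V̄0-coordinates (proj₁ (to V̄00⇔V̄0×q≡false x∈V̄₀₀)))

    dim-V̄00⇒ : (∃ λ d → HasDim (V̄00 A) d × 1 ℕ.≤ d) → (2 ℕ.≤ p ⊎ 1 ℕ.≤ t ℕ.* 2 ℕ.+ m)
    dim-V̄00⇒ (ℕ.suc d , (w , w∈V̄₀₀ , w-linIndep , _) , _)
      with 2 ℕ.≤? p | 1 ℕ.≤? t ℕ.* 2 ℕ.+ m
    ... | yes 2≤p | _       = inj₁ 2≤p
    ... | no _    | yes 1≤N = inj₂ 1≤N
    ... | no 2≰p  | no 1≰N  = ⊥-elim (LinIndep₂⇒head≉0̄ {u = w} w-linIndep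
      (V̄00-trivial (ℕ.≤-pred (ℕ.≰⇒> 2≰p)) (ℕ.n<1⇒n≡0 (ℕ.≰⇒> 1≰N)) (w∈V̄₀₀ zero)))

  module AdaptedBasis-p≡0 (r s t m : ℕ) (A : Mat (Layout.n r s t 0 m)) (A-sym : Symmetric A)
    (b : Fin (Layout.n r s t 0 m) → Vecℤ (Layout.n r s t 0 m)) (b-basis : IsZBasis b)
    (gram : ∀ i j → form A (b i) (b j) ≡mod4 Layout.gramTarget r s t 0 m i j) where

    open Layout r s t 0 m
    open QuadraticRefinement A A-sym
    open AdaptedBasis r s t 0 m A A-sym b b-basis gram public

    q-vanishes : ∀ {x} → V̄0 A x → q A x ≡ false
    q-vanishes x∈V̄₀ = Coordinates.q≡Σ₂ (V̄0-coordinates x∈V̄₀)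

    q-not-surjective : ¬ (∀ y → ∃ λ x → V̄0 A x × q A x ≡ y)
    q-not-surjective q-onto =
      true≢false (trans (sym (proj₂ (proj₂ (q-onto true)))) (q-vanishes (proj₁ (proj₂ (q-onto true)))))

    V̄0⇔V̄00 : ∀ {x} → V̄0 A x ⇔ V̄00 A x
    V̄0⇔V̄00 = mk⇔ (λ x∈V̄₀ → from V̄00⇔V̄0×q≡false (x∈V̄₀ , q-vanishes x∈V̄₀))
                  (proj₁ ∘ to V̄00⇔V̄0×q≡false)
      where open Equivalence

    dim-V̄00⇐ : (2 ℕ.≤ 0 ⊎ 1 ℕ.≤ t ℕ.* 2 ℕ.+ m) → ∃ λ d → HasDim (V̄00 A) d × 1 ℕ.≤ d
    dim-V̄00⇐ (inj₁ ())
    dim-V̄00⇐ (inj₂ 1≤N) = t ℕ.* 2 ℕ.+ m , (u , IsBasisOf-resp (λ _ → V̄0⇔V̄00) u-basis) , 1≤N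

    V̄0/V̄00-dim : HasQuotDim (V̄0 A) (V̄00 A) 0
    V̄0/V̄00-dim = (λ ()) , (λ ()) , (λ _ _ ()) ,
      λ x x∈V̄₀ → (λ ()) , V̄00-resp (λ i → sym (Bool.xor-identityʳ (x i))) (to V̄0⇔V̄00 x∈V̄₀)
      where open Equivalence

  module AdaptedBasis-p≥1 (r s t p m : ℕ) (A : Mat (Layout.n r s t (ℕ.suc p) m)) (A-sym : Symmetric A)
    (b : Fin (Layout.n r s t (ℕ.suc p) m) → Vecℤ (Layout.n r s t (ℕ.suc p) m)) (b-basis : IsZBasis b)
    (gram : ∀ i j → form A (b i) (b j) ≡mod4 Layout.gramTarget r s t (ℕ.suc p) m i j) where

    open Layout r s t (ℕ.suc p) m
    open Fam b
    open QuadraticRefinement A A-sym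
    open AdaptedBasis r s t (ℕ.suc p) m A A-sym b b-basis gram public
    open Equivalence

    q-surjective : ∀ y → ∃ λ x → V̄0 A x × q A x ≡ y
    q-surjective true  = ā zero , ā∈V̄0 zero , q-ā zero
    q-surjective false = 0̄ , V̄0-0̄ , q-0̄

    q-not-vanishing : ¬ (∀ x → V̄0 A x → q A x ≡ false)
    q-not-vanishing q≡false = true≢false (trans (sym (q-ā zero)) (q≡false (ā zero) (ā∈V̄0 zero)))

    V̄0/V̄00-dim : HasQuotDim (V̄0 A) (V̄00 A) 1
    V̄0/V̄00-dim = (λ _ → ā zero) , (λ _ → ā∈V̄0 zero) , independent , spans
      where
      q-comb₂-ā : ∀ (c : Fin 1 → Bool) → q A (comb₂ c (λ _ → ā zero)) ≡ c zero
      q-comb₂-ā c = trans (q-comb₂ c (λ _ → ā∈V̄0 zero))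
        (trans (Σ₂-∧-true c (λ _ → q-ā zero)) (Bool.xor-identityʳ (c zero)))
      independent : ∀ c → V̄00 A (comb₂ c (λ _ → ā zero)) → ∀ j → c j ≡ false
      independent c comb∈V̄₀₀ zero = trans (sym (q-comb₂-ā c)) (proj₂ (to V̄00⇔V̄0×q≡false comb∈V̄₀₀))
      spans : ∀ x → V̄0 A x → ∃ λ c → V̄00 A (x ⊕ comb₂ c (λ _ → ā zero))
      spans x x∈V̄₀ = c , from V̄00⇔V̄0×q≡false (V̄0-⊕ x∈V̄₀ comb∈V̄₀ ,
        trans (q-⊕ x∈V̄₀ comb∈V̄₀) (trans (cong (q A x xor_) (q-comb₂-ā c)) (Bool.xor-same (q A x))))
        where
        c : Fin 1 → Bool
        c _ = q A x
        comb∈V̄₀ = V̄0-comb₂ c (λ _ → ā∈V̄0 zero)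

    -- The family a′ of sums a₁ + a_{j+1} is a parameter so that, for p = 2, it can be taken literally
    -- as written in the statement.
    module _ (a′ : Fin p → V̄ n) (a′≡ : ∀ j → a′ j ≡ (ā zero ⊕ ā (suc j))) where

      comb₂-a′ : ∀ c → comb₂ c a′ ≈ comb₂ (Σ₂ c ∷ c) ā
      comb₂-a′ c =
        ≈-trans (comb₂-cong {c = c} (λ _ → refl) (λ j → cong-app (a′≡ j))) (comb₂-differences ā c)

      V̄00-linIndep : LinIndep₂ (ḡ ++ (a′ ++ h̄))
      V̄00-linIndep c comb≈0 = ↑-elim {P = λ l → c l ≡ false} cg≡false
        (↑-elim {P = λ l → c (N₂ ↑ʳ l) ≡ false} (ca≡false ∘ suc) ch≡false)
        where
        ca = take p (drop N₂ c)
        parts≈0 = ≈-trans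
          (λ i → sym (cong (comb₂ (take N₂ c) ḡ i xor_)
                           (cong (_xor comb₂ (drop p (drop N₂ c)) h̄ i) (comb₂-a′ ca i))))
          (≈-trans (≈-sym (comb₂-++₃ c ḡ a′ h̄)) comb≈0)
        zeros = u-independent (take N₂ c) (Σ₂ ca ∷ ca) (drop p (drop N₂ c)) parts≈0
        cg≡false = proj₁ zeros
        ca≡false = proj₁ (proj₂ zeros)
        ch≡false = proj₂ (proj₂ zeros)

      V̄00-spans : ∀ x → V̄00 A x → ∃ λ c → comb₂ c (ḡ ++ (a′ ++ h̄)) ≈ x
      V̄00-spans x x∈V̄₀₀ = take N₂ c ++ (ca ∘ suc ++ drop (ℕ.suc p) (drop N₂ c)) , λ i → begin
        comb₂ (take N₂ c ++ (ca ∘ suc ++ drop (ℕ.suc p) (drop N₂ c))) (ḡ ++ (a′ ++ h̄)) i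
          ≡⟨ comb₂-++-++₃ (take N₂ c) (ca ∘ suc) (drop (ℕ.suc p) (drop N₂ c)) ḡ a′ h̄ i ⟩
        comb₂ (take N₂ c) ḡ i xor (comb₂ (ca ∘ suc) a′ i xor comb₂ (drop (ℕ.suc p) (drop N₂ c)) h̄ i)
          ≡⟨ cong (λ y → comb₂ (take N₂ c) ḡ i xor (y xor comb₂ (drop (ℕ.suc p) (drop N₂ c)) h̄ i))
                  (trans (comb₂-a′ (ca ∘ suc) i) (comb₂-cong {u = ā} ca≗ (λ _ _ → refl) i)) ⟩
        comb₂ (take N₂ c) ḡ i xor (comb₂ ca ā i xor comb₂ (drop (ℕ.suc p) (drop N₂ c)) h̄ i)
          ≡⟨ sym (comb₂-u c i) ⟩
        comb₂ c u i
          ≡⟨ comb₂≈ i ⟩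
        x i ∎
        where
        open Coordinates (V̄0-coordinates (proj₁ (to V̄00⇔V̄0×q≡false x∈V̄₀₀))) renaming (coeff to c)
        ca = take (ℕ.suc p) (drop N₂ c)
        Σca≡false : Σ₂ ca ≡ false
        Σca≡false = trans (sym q≡Σ₂) (proj₂ (to V̄00⇔V̄0×q≡false x∈V̄₀₀))
        ca≗ : (Σ₂ (ca ∘ suc) ∷ ca ∘ suc) ≗ ca
        ca≗ zero    = sym (xor≡false⇒≡ (ca zero) (Σ₂ (ca ∘ suc)) Σca≡false)
        ca≗ (suc j) = refl

      V̄00-basis : IsBasisOf (V̄00 A) (ḡ ++ (a′ ++ h̄))
      V̄00-basis =
        ∀-++ {P = V̄00 A} ḡ∈V̄00 (∀-++ {P = V̄00 A} a′∈V̄00 h̄∈V̄00) , V̄00-linIndep , V̄00-spans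
        where
        ḡ∈V̄00 = λ k → from V̄00⇔V̄0×q≡false (ḡ∈V̄0 k , q-ḡ k)
        h̄∈V̄00 = λ j → from V̄00⇔V̄0×q≡false (h̄∈V̄0 j , q-h̄ j)
        a′∈V̄00 = λ j → subst (V̄00 A) (sym (a′≡ j)) (from V̄00⇔V̄0×q≡false
          (V̄0-⊕ (ā∈V̄0 zero) (ā∈V̄0 (suc j)) ,
           trans (q-⊕ (ā∈V̄0 zero) (ā∈V̄0 (suc j))) (cong₂ _xor_ (q-ā zero) (q-ā (suc j)))))

    dim-V̄00⇐ : (2 ℕ.≤ ℕ.suc p ⊎ 1 ℕ.≤ t ℕ.* 2 ℕ.+ m) → ∃ λ d → HasDim (V̄00 A) d × 1 ℕ.≤ d
    dim-V̄00⇐ 2≤p⊎1≤N =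
      t ℕ.* 2 ℕ.+ (p ℕ.+ m) , (_ , V̄00-basis (λ j → ā zero ⊕ ā (suc j)) (λ _ → refl)) , 1≤size 2≤p⊎1≤N
      where
      1≤size : 2 ℕ.≤ ℕ.suc p ⊎ 1 ℕ.≤ t ℕ.* 2 ℕ.+ m → 1 ℕ.≤ t ℕ.* 2 ℕ.+ (p ℕ.+ m)
      1≤size (inj₁ (ℕ.s≤s 1≤p)) =
        ℕ.≤-trans 1≤p (ℕ.≤-trans (ℕ.m≤m+n p m) (ℕ.m≤n+m (p ℕ.+ m) (t ℕ.* 2)))
      1≤size (inj₂ 1≤N)         = ℕ.≤-trans 1≤N (ℕ.+-monoʳ-≤ (t ℕ.* 2) (ℕ.m≤n+m m p))

V̄00-basis-p≡1 : (r s t p m : ℕ) (A : Mat (Layout.n r s t p m)) → Symmetric A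
  → (b : Fin (Layout.n r s t p m) → Vecℤ (Layout.n r s t p m)) → IsZBasis b
  → (∀ i j → form A (b i) (b j) ≡mod4 Layout.gramTarget r s t p m i j)
  → p ≡ 1 → IsBasisOf (V̄00 A) (Layout.Fam.ḡ r s t p m b ++ Layout.Fam.h̄ r s t p m b)
V̄00-basis-p≡1 r s t _ m A A-sym b b-basis gram refl =
  AdaptedBasis-p≥1.V̄00-basis r s t 0 m A A-sym b b-basis gram (λ ()) (λ ())

V̄00-basis-p≡2 : (r s t p m : ℕ) (A : Mat (Layout.n r s t p m)) → Symmetric A
  → (b : Fin (Layout.n r s t p m) → Vecℤ (Layout.n r s t p m)) → IsZBasis b
  → (∀ i j → form A (b i) (b j) ≡mod4 Layout.gramTarget r s t p m i j)
  → (e : p ≡ 2) → IsBasisOf (V̄00 A)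
       (Layout.Fam.ḡ r s t p m b
         ++ ((λ (_ : Fin 1) → Layout.Fam.ā r s t p m b (subst Fin (sym e) zero)
                               ⊕ Layout.Fam.ā r s t p m b (subst Fin (sym e) (suc zero)))
         ++ Layout.Fam.h̄ r s t p m b))
V̄00-basis-p≡2 r s t _ m A A-sym b b-basis gram refl =
  AdaptedBasis-p≥1.V̄00-basis r s t 1 m A A-sym b b-basis gram _ (λ { zero → refl })

open import Data.Nat.Base using (_≤_; _*_; _+_; z≤n; s≤s)

lemma2p7 : (r s t p m : ℕ) (A : Mat (Layout.n r s t p m))
    → Symmetric A → EvenDiagonal A
    → (b : Fin (Layout.n r s t p m) → Vecℤ (Layout.n r s t p m)) → IsZBasis b
    → (∀ i j → form A (b i) (b j) ≡mod4 Layout.gramTarget r s t p m i j)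
    → IsBasisOf (V̄0 A) (Layout.Fam.ḡ r s t p m b ++ (Layout.Fam.ā r s t p m b ++ Layout.Fam.h̄ r s t p m b))
      × IsBasisOf (V̄000 A) (Layout.Fam.h̄ r s t p m b)
      × (p ≡ 0 → ∀ x → V̄0 A x ⇔ V̄00 A x)
      × (p ≡ 1 → IsBasisOf (V̄00 A) (Layout.Fam.ḡ r s t p m b ++ Layout.Fam.h̄ r s t p m b))
      × ((e : p ≡ 2) → IsBasisOf (V̄00 A)
           (Layout.Fam.ḡ r s t p m b
             ++ ((λ (_ : Fin 1) → Layout.Fam.ā r s t p m b (subst Fin (sym e) zero)
                                   ⊕ Layout.Fam.ā r s t p m b (subst Fin (sym e) (suc zero)))
             ++ Layout.Fam.h̄ r s t p m b)))
      × ((∃ λ d → HasDim (V̄00 A) d × 1 ≤ d) ⇔ (2 ≤ p ⊎ 1 ≤ t * 2 + m))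
      × (∃ λ d → HasQuotDim (V̄0 A) (V̄00 A) d × d ≤ 1 × (d ≡ 1 ⇔ 1 ≤ p))
      × ((∀ x → V̄0 A x → q A x ≡ false) ⇔ p ≡ 0)
      × ((∀ (y : Bool) → ∃ λ x → V̄0 A x × q A x ≡ y) ⇔ 1 ≤ p)
lemma2p7 r s t 0 m A A-sym _ b b-basis gram =
  u-basis , h̄-basis , (λ _ _ → V̄0⇔V̄00) , (λ ()) , (λ ()) , mk⇔ dim-V̄00⇒ dim-V̄00⇐ ,
  (0 , V̄0/V̄00-dim , z≤n , mk⇔ (λ ()) (λ ())) ,
  mk⇔ (λ _ → refl) (λ _ _ → q-vanishes) , mk⇔ (⊥-elim ∘ q-not-surjective) (λ ())
  where open AdaptedBasis-p≡0 r s t m A A-sym b b-basis gram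
lemma2p7 r s t (ℕ.suc p) m A A-sym _ b b-basis gram =
  u-basis , h̄-basis , (λ ()) , V̄00-basis-p≡1 r s t (ℕ.suc p) m A A-sym b b-basis gram ,
  V̄00-basis-p≡2 r s t (ℕ.suc p) m A A-sym b b-basis gram , mk⇔ dim-V̄00⇒ dim-V̄00⇐ ,
  (1 , V̄0/V̄00-dim , s≤s z≤n , mk⇔ (λ _ → s≤s z≤n) (λ _ → refl)) ,
  mk⇔ (⊥-elim ∘ q-not-vanishing) (λ ()) , mk⇔ (λ _ → s≤s z≤n) (λ _ → q-surjective)
  where open AdaptedBasis-p≥1 r s t p m A A-sym b b-basis gram
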